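{- Let $\mathcal{H}_m=V_m/(O_m+T_m)$, where $V_m$ is the complex vector space with basis $\mathbb{S}_m$ and $O_m$, $T_m$ are the spans of all one-hyper-arc and two-hyper-arc elements respectively. For $\alpha\in\mathbb{S}_a$, $\beta\in\mathbb{S}_b$ and all integers $i,j$, the classes of $\alpha\#\beta$ and of $(\sigma_a^{ -i}\alpha\sigma_a^{i})\#(\sigma_b^{ -j}\beta\sigma_b^{j})$ in $\mathcal{H}_{a+b}$ coincide, where $\sigma_n=(1,2,\dots,n)$. That is, the product of two hyper chord diagrams, defined as the class of the concatenation of hyper arc diagrams representing them, does not depend on the choice of these representatives.
   Context: A hyper arc diagram is a permutation $\alpha\in\mathbb{S}_m$ (points $1,\dots,m$ in increasing order on a line; cycles are hyper arcs, their elements legs); a hyper chord diagram is its class under $\alpha\sim\sigma_m^{ -k}\alpha\sigma_m^k$. Concatenation: for $\alpha\in\mathbb{S}_a$, $\beta\in\mathbb{S}_b$, $\alpha\#\beta\in\mathbb{S}_{a+b}$ acts as $\alpha$ on $\{1,\dots,a\}$ and as $j\mapsto a+\beta(j-a)$ on $\{a+1,\dots,a+b\}$. For $\alpha\in\mathbb{S}_m$ and distinct $p,q$, $\alpha^{p\to q^- }$ (resp. $\alpha^{p\to q^+}$) is $\varphi\alpha\varphi^{ -1}$, where $\varphi$ sends each element to its position in the linear order obtained from $1<\dots<m$ by removing $p$ and reinserting it immediately before (resp. after) $q$. A one-hyper-arc element is $\sum_{q\in c,q\ne p}(\alpha^{p\to q^- }-\alpha^{p\to q^+})$ for a cycle $c$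 of $\alpha$ and $p\in c$; a two-hyper-arc element is $\sum_{q\in c'}(\alpha^{p\to q^- }-\alpha^{p\to q^+})$ for a leg $p$ of $\alpha$ and a cycle $c'$ of $\alpha$ not containing $p$. -}

module Defs where

open import Data.Bool using (Bool; true; false; if_then_else_; _∧_; _∨_; not)
open import Data.Nat as ℕ using (ℕ; zero; suc; _≡ᵇ_; _<ᵇ_)
open import Data.Integer as ℤ using (ℤ)
open import Data.Integer.DivMod using (_%ℕ_)
open import Data.Fin as Fin using (Fin; toℕ; splitAt; join)
open import Data.Nat.DivMod using (_mod_)
open import Data.Sum using (inj₁; inj₂)
open import Data.List using (List; []; _∷_; filter; map; upTo; foldr)
open import Data.Product using (_×_; _,_; ∃; Σ)
open import Data.Rational as ℚ using (ℚ; 0ℚ; 1ℚ)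
open import Data.Fin.Permutation using (Permutation′; _⟨$⟩ʳ_)
open import Relation.Binary.PropositionalEquality using (_≡_)

allᵇ : ∀ n → (Fin n → Bool) → Bool
allᵇ zero    P = true
allᵇ (suc n) P = P Fin.zero ∧ allᵇ n (λ i → P (Fin.suc i))

anyᵇ : ∀ n → (Fin n → Bool) → Bool
anyᵇ zero    P = false
anyᵇ (suc n) P = P Fin.zero ∨ anyᵇ n (λ i → P (Fin.suc i))

ΣFin : ∀ n → (Fin n → ℚ) → ℚ
ΣFin zero    f = 0ℚ
ΣFin (suc n) f = f Fin.zero ℚ.+ ΣFin n (λ i → f (Fin.suc i))

_≟ᶠ_ : ∀ {n} → Fin n → Fin n → Bool
x ≟ᶠ y = toℕ x ≡ᵇ toℕ y

-- an element of S_m, points 0..m-1 (standing for 1..m)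
Perm : ℕ → Set
Perm m = Permutation′ m

iter : ∀ {m} → Perm m → ℕ → Fin m → Fin m
iter α zero    x = x
iter α (suc k) x = α ⟨$⟩ʳ iter α k x

-- q lies in the cycle (hyper arc) of α containing p:
-- q = α^k p for some k; k < m suffices since orbits have size ≤ m.
sameCycleᵇ : ∀ {m} → Perm m → Fin m → Fin m → Bool
sameCycleᵇ {m} α p q = anyᵇ m (λ k → iter α (toℕ k) p ≟ᶠ q)

removeₗ : ℕ → ℕ → List ℕ
removeₗ m p = filter (λ x → Data.Bool._≟_ (x ≡ᵇ p) false) (upTo m)
  where import Data.Bool

insertBefore : ℕ → ℕ → List ℕ → List ℕ
insertBefore q p []       = []
insertBefore q p (y ∷ ys) = if y ≡ᵇ q then p ∷ y ∷ ys else y ∷ insertBefore q p ys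

insertAfter : ℕ → ℕ → List ℕ → List ℕ
insertAfter q p []       = []
insertAfter q p (y ∷ ys) = if y ≡ᵇ q then y ∷ p ∷ ys else y ∷ insertAfter q p ys

indexOf : ℕ → List ℕ → ℕ
indexOf x []       = 0
indexOf x (y ∷ ys) = if x ≡ᵇ y then 0 else suc (indexOf x ys)

-- φ for p → q^- and p → q^+ (as position maps, values in ℕ)
φ⁻ φ⁺ : ∀ m → Fin m → Fin m → Fin m → ℕ
φ⁻ m p q x = indexOf (toℕ x) (insertBefore (toℕ q) (toℕ p) (removeₗ m (toℕ p)))
φ⁺ m p q x = indexOf (toℕ x) (insertAfter  (toℕ q) (toℕ p) (removeₗ m (toℕ p)))

-- A vector is given by its coefficient function; we index coefficients
-- by all maps Fin m → Fin m (non-bijective maps always get coefficient 0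
-- in everything considered here), compared pointwise.

Vect : ℕ → Set
Vect m = (Fin m → Fin m) → ℚ

δ : ∀ {m} → (Fin m → Fin m) → Vect m
δ {m} f γ = if allᵇ m (λ x → γ x ≟ᶠ f x) then 1ℚ else 0ℚ

-- basis vector of φ α φ⁻¹, where φ : Fin m → positions is a bijection:
-- γ = φ α φ⁻¹  iff  γ (φ x) = φ (α x) for all x.
δConj : ∀ {m} → (Fin m → ℕ) → Perm m → Vect m
δConj {m} φ α γ =
  if allᵇ m (λ x → allᵇ m (λ y →
       not (toℕ y ≡ᵇ φ x) ∨ (toℕ (γ y) ≡ᵇ φ (α ⟨$⟩ʳ x))))
  then 1ℚ else 0ℚ

δMove : ∀ {m} → Perm m → Fin m → Fin m → Vect m
δMove {m} α p q γ = δConj (φ⁻ m p q) α γ ℚ.- δConj (φ⁺ m p q) α γ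

oneArc : ∀ {m} → Perm m → Fin m → Vect m
oneArc {m} α p γ =
  ΣFin m (λ q → if sameCycleᵇ α p q ∧ not (q ≟ᶠ p) then δMove α p q γ else 0ℚ)

twoArc : ∀ {m} → Perm m → Fin m → Fin m → Vect m
twoArc {m} α p r γ =
  ΣFin m (λ q → if sameCycleᵇ α r q then δMove α p q γ else 0ℚ)

data Gen (m : ℕ) : Set where
  one : (α : Perm m) (p : Fin m) → Gen m
  two : (α : Perm m) (p r : Fin m) → sameCycleᵇ α r p ≡ false → Gen m

⟦_⟧ : ∀ {m} → Gen m → Vect m
⟦ one α p ⟧       = oneArc α p
⟦ two α p r _ ⟧   = twoArc α p r

InOT : ∀ m → Vect m → Set
InOT m v = Σ (List (ℚ × Gen m)) λ cs →
  ∀ γ → v γ ≡ foldr ℚ._+_ 0ℚ (map (λ { (c , g) → c ℚ.* ⟦ g ⟧ γ }) cs)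

_≈H_ : ∀ {m} → Vect m → Vect m → Set
_≈H_ {m} v w = InOT m (λ γ → v γ ℚ.- w γ)

_#_ : ∀ {a b} → (Fin a → Fin a) → (Fin b → Fin b) → Fin (a ℕ.+ b) → Fin (a ℕ.+ b)
_#_ {a} {b} f g x with splitAt a x
... | inj₁ i = join a b (inj₁ (f i))
... | inj₂ j = join a b (inj₂ (g j))

σ σ⁻¹ : ∀ {n} → Fin (suc n) → Fin (suc n)
σ   {n} x = (suc (toℕ x)) mod (suc n)
σ⁻¹ {n} x = (toℕ x ℕ.+ n) mod (suc n)

rotℕ : ∀ {n} → ℕ → (Fin (suc n) → Fin (suc n)) → Fin (suc n) → Fin (suc n)
rotℕ zero    f = f
rotℕ (suc k) f = λ x → σ⁻¹ (rotℕ k f (σ x))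

-- σ_n^{-i} α σ_n^{i} for i ∈ ℤ (as a map; σ_n has order n, so σ_n^i = σ_n^(i mod n))
rot : ∀ n → ℤ → Perm n → Fin n → Fin n
rot zero    i α = α ⟨$⟩ʳ_
rot (suc n) i α = rotℕ (i %ℕ suc n) (α ⟨$⟩ʳ_)

-- Conjugating α by σ moves the first leg of α to the end of its block of
-- points.  In α # β each factor occupies a block [s, e) that is a union of
-- cycles, and moving the leg p = s past the legs q = s + 1, …, e - 1 one at a
-- time changes the diagram by α^{p→q⁻} − α^{p→q⁺}; since α^{p→q⁺} = α^{p→(q+1)⁻},
-- these differences telescope to (α # β) minus the rotated concatenation.
-- Grouping the legs q by their cycle, the same sum is the one-hyper-arc element
-- of the cycle of p plus one two-hyper-arc element for each other cycle of the
-- block, hence lies in O + T.  Iterating gives all powers σ^i and σ^j.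

module Submission where

open import Defs
open import Data.Nat using (ℕ; _+_)
open import Data.Integer using (ℤ)
open import Data.Fin.Permutation using (_⟨$⟩ʳ_)

open import Data.Bool as Bool using (Bool; true; false; if_then_else_; _∧_; _∨_; not; T)
open import Data.Bool.Properties using (¬-not; ∧-zeroʳ; ∧-identityʳ)
open import Data.Empty using (⊥-elim)
open import Data.Fin as Fin using (Fin; toℕ; _↑ˡ_; _↑ʳ_; splitAt)
import Data.Fin.Properties as FinP
open import Data.Fin.Permutation using (_⟨$⟩ˡ_; inverseˡ; inverseʳ; permutation)
open import Data.Integer.DivMod using (_%ℕ_)
open import Data.List using (List; []; _∷_; _++_; foldr; map; filter; upTo; applyUpTo)
import Data.List.Properties as ListP
open import Data.List.Relation.Unary.All using (All; []; _∷_)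
open import Data.Nat as ℕ using (zero; suc; _*_; _∸_; _≤_; _<_; _≡ᵇ_; _<ᵇ_; _≤ᵇ_; z≤n; s≤s)
import Data.Nat.Properties as ℕP
open import Data.Nat.DivMod using (_%_; _/_; m≡m%n+[m/n]*n; m%n<n; n%n≡0; [m+n]%n≡m%n; m<n⇒m%n≡m)
import Data.Nat.Solver
open import Data.Product using (∃; _×_; _,_)
open import Data.Rational using (ℚ; 0ℚ; 1ℚ) renaming (_+_ to _⊕_; _-_ to _⊖_)
import Data.Rational.Properties as ℚP
import Data.Rational.Solver
open import Data.Sum as Sum using (_⊎_; inj₁; inj₂; [_,_])
open import Function using (_∘′_)
open import Relation.Binary.Definitions using (tri<; tri≈; tri>)
open import Relation.Binary.PropositionalEquality hiding ([_])
import Relation.Binary.Reasoning.Base.Single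
open import Relation.Nullary using (yes; no)

module ℕ-Solver = Data.Nat.Solver.+-*-Solver
module ℚ-Solver = Data.Rational.Solver.+-*-Solver

true⇒T : ∀ {b} → b ≡ true → T b
true⇒T refl = _

T⇒true : ∀ {b} → T b → b ≡ true
T⇒true {true} _ = refl

true≢false : true ≢ false
true≢false ()

∧-trueˡ : ∀ {a b} → a ∧ b ≡ true → a ≡ true
∧-trueˡ {true} _ = refl

∧-trueʳ : ∀ {a b} → a ∧ b ≡ true → b ≡ true
∧-trueʳ {true} eq = eq

∧-true : ∀ {a b} → a ≡ true → b ≡ true → a ∧ b ≡ true
∧-true refl refl = refl

not-false : ∀ {b} → b ≡ false → not b ≡ true
not-false refl = refl

true⇔⇒≡ : (b c : Bool) → (b ≡ true → c ≡ true) → (c ≡ true → b ≡ true) → b ≡ c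
true⇔⇒≡ true  c     f g = sym (f refl)
true⇔⇒≡ false true  f g = g refl
true⇔⇒≡ false false f g = refl

if-true : ∀ {A : Set} {b} {x y : A} → b ≡ true → (if b then x else y) ≡ x
if-true refl = refl

if-false : ∀ {A : Set} {b} {x y : A} → b ≡ false → (if b then x else y) ≡ y
if-false refl = refl

≡ᵇ-true⇒≡ : ∀ m n → (m ≡ᵇ n) ≡ true → m ≡ n
≡ᵇ-true⇒≡ m n eq = ℕP.≡ᵇ⇒≡ m n (true⇒T eq)

≡⇒≡ᵇ-true : ∀ m n → m ≡ n → (m ≡ᵇ n) ≡ true
≡⇒≡ᵇ-true m n eq = T⇒true (ℕP.≡⇒≡ᵇ m n eq)

≡ᵇ-refl : ∀ m → (m ≡ᵇ m) ≡ true
≡ᵇ-refl m = ≡⇒≡ᵇ-true m m refl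

≢⇒≡ᵇ-false : ∀ m n → m ≢ n → (m ≡ᵇ n) ≡ false
≢⇒≡ᵇ-false m n m≢n = ¬-not (λ eq → m≢n (≡ᵇ-true⇒≡ m n eq))

<ᵇ-true⇒< : ∀ m n → (m <ᵇ n) ≡ true → m < n
<ᵇ-true⇒< m n eq = ℕP.<ᵇ⇒< m n (true⇒T eq)

<⇒<ᵇ-true : ∀ {m n} → m < n → (m <ᵇ n) ≡ true
<⇒<ᵇ-true m<n = T⇒true (ℕP.<⇒<ᵇ m<n)

≥⇒<ᵇ-false : ∀ {m n} → n ≤ m → (m <ᵇ n) ≡ false
≥⇒<ᵇ-false {m} {n} n≤m = ¬-not (λ eq → ℕP.<⇒≱ (<ᵇ-true⇒< m n eq) n≤m)

≤ᵇ-true⇒≤ : ∀ m n → (m ≤ᵇ n) ≡ true → m ≤ n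
≤ᵇ-true⇒≤ m n eq = ℕP.≤ᵇ⇒≤ m n (true⇒T eq)

≤⇒≤ᵇ-true : ∀ {m n} → m ≤ n → (m ≤ᵇ n) ≡ true
≤⇒≤ᵇ-true m≤n = T⇒true (ℕP.≤⇒≤ᵇ m≤n)

>⇒≤ᵇ-false : ∀ {m n} → n < m → (m ≤ᵇ n) ≡ false
>⇒≤ᵇ-false {m} {n} n<m = ¬-not (λ eq → ℕP.<⇒≱ n<m (≤ᵇ-true⇒≤ m n eq))

≟ᶠ-true⇒≡ : ∀ {m} (x y : Fin m) → (x ≟ᶠ y) ≡ true → x ≡ y
≟ᶠ-true⇒≡ x y eq = FinP.toℕ-injective (≡ᵇ-true⇒≡ _ _ eq)

≟ᶠ-refl : ∀ {m} (x : Fin m) → (x ≟ᶠ x) ≡ true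
≟ᶠ-refl x = ≡ᵇ-refl (toℕ x)

allᵇ⁻ : ∀ n P → allᵇ n P ≡ true → ∀ i → P i ≡ true
allᵇ⁻ (suc n) P eq Fin.zero    = ∧-trueˡ {P Fin.zero} eq
allᵇ⁻ (suc n) P eq (Fin.suc i) = allᵇ⁻ n (λ i → P (Fin.suc i)) (∧-trueʳ {P Fin.zero} eq) i

allᵇ⁺ : ∀ n P → (∀ i → P i ≡ true) → allᵇ n P ≡ true
allᵇ⁺ zero    P h = refl
allᵇ⁺ (suc n) P h = ∧-true (h Fin.zero) (allᵇ⁺ n (λ i → P (Fin.suc i)) (λ i → h (Fin.suc i)))

allᵇ-cong : ∀ n P Q → (∀ i → P i ≡ Q i) → allᵇ n P ≡ allᵇ n Q
allᵇ-cong zero    P Q h = refl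
allᵇ-cong (suc n) P Q h = cong₂ _∧_ (h Fin.zero) (allᵇ-cong n _ _ (λ i → h (Fin.suc i)))

anyᵇ⁻ : ∀ n P → anyᵇ n P ≡ true → ∃ λ i → P i ≡ true
anyᵇ⁻ (suc n) P eq with P Fin.zero in P₀
... | true  = Fin.zero , P₀
... | false with anyᵇ⁻ n (λ i → P (Fin.suc i)) eq
...   | i , Pi = Fin.suc i , Pi

anyᵇ⁺ : ∀ n P i → P i ≡ true → anyᵇ n P ≡ true
anyᵇ⁺ (suc n) P Fin.zero    Pi rewrite Pi = refl
anyᵇ⁺ (suc n) P (Fin.suc i) Pi with P Fin.zero
... | true  = refl
... | false = anyᵇ⁺ n (λ i → P (Fin.suc i)) i Pi

argmin : ∀ {n} → Fin n → (g : Fin n → ℕ) → ∃ λ i → ∀ j → g i ≤ g j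
argmin {suc zero}    _ g = Fin.zero , λ { Fin.zero → ℕP.≤-refl }
argmin {suc (suc n)} _ g with argmin Fin.zero (λ j → g (Fin.suc j))
... | i , gi≤ with g Fin.zero ℕ.≤? g (Fin.suc i)
...   | yes g₀≤ = Fin.zero , λ { Fin.zero → ℕP.≤-refl ; (Fin.suc j) → ℕP.≤-trans g₀≤ (gi≤ j) }
...   | no  g₀≰ = Fin.suc i , λ { Fin.zero → ℕP.<⇒≤ (ℕP.≰⇒> g₀≰) ; (Fin.suc j) → gi≤ j }

ΣFin-cong : ∀ n {f g : Fin n → ℚ} → (∀ i → f i ≡ g i) → ΣFin n f ≡ ΣFin n g
ΣFin-cong zero    h = refl
ΣFin-cong (suc n) h = cong₂ _⊕_ (h Fin.zero) (ΣFin-cong n (λ i → h (Fin.suc i)))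

ΣFin-zero : ∀ n {f : Fin n → ℚ} → (∀ i → f i ≡ 0ℚ) → ΣFin n f ≡ 0ℚ
ΣFin-zero zero    h = refl
ΣFin-zero (suc n) h = trans (cong₂ _⊕_ (h Fin.zero) (ΣFin-zero n (λ i → h (Fin.suc i)))) (ℚP.+-identityˡ 0ℚ)

ΣFin-+ : ∀ n (f g : Fin n → ℚ) → ΣFin n (λ i → f i ⊕ g i) ≡ ΣFin n f ⊕ ΣFin n g
ΣFin-+ zero    f g = sym (ℚP.+-identityˡ 0ℚ)
ΣFin-+ (suc n) f g rewrite ΣFin-+ n (λ i → f (Fin.suc i)) (λ i → g (Fin.suc i)) =
  solve 4 (λ a b c d → (a :+ b) :+ (c :+ d) := (a :+ c) :+ (b :+ d)) refl
    (f Fin.zero) (g Fin.zero) (ΣFin n (λ i → f (Fin.suc i))) (ΣFin n (λ i → g (Fin.suc i)))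
  where open ℚ-Solver

ΣFin-comm : ∀ n k (f : Fin n → Fin k → ℚ) →
  ΣFin n (λ i → ΣFin k (f i)) ≡ ΣFin k (λ j → ΣFin n (λ i → f i j))
ΣFin-comm zero    k f = sym (ΣFin-zero k (λ _ → refl))
ΣFin-comm (suc n) k f rewrite ΣFin-comm n k (λ i → f (Fin.suc i)) =
  sym (ΣFin-+ k (f Fin.zero) (λ j → ΣFin n (λ i → f (Fin.suc i) j)))

ΣFin-single : ∀ n (f : Fin n → ℚ) i₀ → (∀ i → i ≢ i₀ → f i ≡ 0ℚ) → ΣFin n f ≡ f i₀
ΣFin-single (suc n) f Fin.zero h =
  trans (cong (f Fin.zero ⊕_) (ΣFin-zero n (λ i → h (Fin.suc i) (λ ())))) (ℚP.+-identityʳ _)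
ΣFin-single (suc n) f (Fin.suc i₀) h =
  trans (cong₂ _⊕_ (h Fin.zero (λ ()))
                   (ΣFin-single n (λ i → f (Fin.suc i)) i₀ (λ i i≢i₀ → h (Fin.suc i) (i≢i₀ ∘′ FinP.suc-injective))))
        (ℚP.+-identityˡ _)

ΣFin-if : ∀ b n (f : Fin n → ℚ) →
  (if b then ΣFin n f else 0ℚ) ≡ ΣFin n (λ i → if b then f i else 0ℚ)
ΣFin-if true  n f = refl
ΣFin-if false n f = sym (ΣFin-zero n (λ _ → refl))

Σℕ : ℕ → (ℕ → ℚ) → ℚ
Σℕ zero    h = 0ℚ
Σℕ (suc n) h = h 0 ⊕ Σℕ n (λ k → h (suc k))

ΣFin-toℕ : ∀ n (h : ℕ → ℚ) → ΣFin n (λ i → h (toℕ i)) ≡ Σℕ n h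
ΣFin-toℕ zero    h = refl
ΣFin-toℕ (suc n) h = cong (h 0 ⊕_) (ΣFin-toℕ n (λ k → h (suc k)))

Σℕ-cong : ∀ n {f g : ℕ → ℚ} → (∀ k → f k ≡ g k) → Σℕ n f ≡ Σℕ n g
Σℕ-cong zero    h = refl
Σℕ-cong (suc n) h = cong₂ _⊕_ (h 0) (Σℕ-cong n (λ k → h (suc k)))

differenceOn : ℕ → ℕ → (ℕ → ℚ) → ℕ → ℚ
differenceOn lo hi X k = if (lo ≤ᵇ k) ∧ (k <ᵇ hi) then X k ⊖ X (suc k) else 0ℚ

differenceOn-suc : ∀ lo hi X k →
  differenceOn lo hi X (suc k) ≡ differenceOn (lo ∸ 1) (hi ∸ 1) (λ j → X (suc j)) k
differenceOn-suc lo hi X k = cong₂ (λ b c → if b ∧ c then X (suc k) ⊖ X (suc (suc k)) else 0ℚ) (lo-shift lo) (hi-shift hi)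
  where
    lo-shift : ∀ lo → (lo ≤ᵇ suc k) ≡ (lo ∸ 1 ≤ᵇ k)
    lo-shift zero          = refl
    lo-shift (suc zero)    = refl
    lo-shift (suc (suc _)) = refl
    hi-shift : ∀ hi → (suc k <ᵇ hi) ≡ (k <ᵇ hi ∸ 1)
    hi-shift zero    = refl
    hi-shift (suc _) = refl

Σℕ-telescope : ∀ n lo hi (X : ℕ → ℚ) → lo ≤ hi → hi ≤ n → Σℕ n (differenceOn lo hi X) ≡ X lo ⊖ X hi
Σℕ-telescope zero    .zero .zero X z≤n z≤n = sym (ℚP.+-inverseʳ (X 0))
Σℕ-telescope (suc n) lo hi X lo≤hi hi≤n =
  trans (cong (differenceOn lo hi X 0 ⊕_)
          (trans (Σℕ-cong n (differenceOn-suc lo hi X))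
                 (Σℕ-telescope n (lo ∸ 1) (hi ∸ 1) (λ j → X (suc j)) (ℕP.∸-monoˡ-≤ 1 lo≤hi) (ℕP.∸-monoˡ-≤ 1 hi≤n))))
        (first-term lo hi lo≤hi)
  where
    open ℚ-Solver
    first-term : ∀ lo hi → lo ≤ hi →
      differenceOn lo hi X 0 ⊕ (X (suc (lo ∸ 1)) ⊖ X (suc (hi ∸ 1))) ≡ X lo ⊖ X hi
    first-term zero zero _ =
      trans (ℚP.+-identityˡ _) (trans (ℚP.+-inverseʳ (X 1)) (sym (ℚP.+-inverseʳ (X 0))))
    first-term zero (suc hi) _ =
      solve 3 (λ a b c → (a :- b) :+ (b :- c) := a :- c) refl (X 0) (X 1) (X (suc hi))
    first-term (suc lo) (suc hi) _ = ℚP.+-identityˡ _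

-- The relation ≈H

sum-++ : ∀ {X : Set} (f : X → ℚ) xs ys →
  foldr _⊕_ 0ℚ (map f (xs ++ ys)) ≡ foldr _⊕_ 0ℚ (map f xs) ⊕ foldr _⊕_ 0ℚ (map f ys)
sum-++ f []       ys = sym (ℚP.+-identityˡ _)
sum-++ f (x ∷ xs) ys rewrite sum-++ f xs ys = sym (ℚP.+-assoc (f x) _ _)

InOT-resp : ∀ {m} {v w : Vect m} → (∀ γ → v γ ≡ w γ) → InOT m v → InOT m w
InOT-resp v≡w (cs , v≡Σ) = cs , λ γ → trans (sym (v≡w γ)) (v≡Σ γ)

InOT-zero : ∀ {m} → InOT m (λ _ → 0ℚ)
InOT-zero = [] , λ _ → refl

InOT-+ : ∀ {m} {v w : Vect m} → InOT m v → InOT m w → InOT m (λ γ → v γ ⊕ w γ)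
InOT-+ (cs , v≡Σ) (ds , w≡Σ) = cs ++ ds , λ γ → trans (cong₂ _⊕_ (v≡Σ γ) (w≡Σ γ)) (sym (sum-++ _ cs ds))

InOT-gen : ∀ {m} (g : Gen m) → InOT m ⟦ g ⟧
InOT-gen g = (1ℚ , g) ∷ [] , λ γ → sym (trans (ℚP.+-identityʳ _) (ℚP.*-identityˡ (⟦ g ⟧ γ)))

InOT-ΣFin : ∀ {m} n (v : Fin n → Vect m) → (∀ i → InOT m (v i)) → InOT m (λ γ → ΣFin n (λ i → v i γ))
InOT-ΣFin zero    v h = InOT-zero
InOT-ΣFin (suc n) v h = InOT-+ (h Fin.zero) (InOT-ΣFin n (λ i → v (Fin.suc i)) (λ i → h (Fin.suc i)))

≈H-reflexive : ∀ {m} {v w : Vect m} → (∀ γ → v γ ≡ w γ) → v ≈H w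
≈H-reflexive {v = v} v≡w = InOT-resp (λ γ → sym (trans (cong (v γ ⊖_) (sym (v≡w γ))) (ℚP.+-inverseʳ (v γ)))) InOT-zero

≈H-refl : ∀ {m} {v : Vect m} → v ≈H v
≈H-refl {v = v} = ≈H-reflexive {v = v} (λ _ → refl)

≈H-trans : ∀ {m} {u v w : Vect m} → u ≈H v → v ≈H w → u ≈H w
≈H-trans {u = u} {v} {w} u≈v v≈w = InOT-resp
  (λ γ → solve 3 (λ a b c → (a :- b) :+ (b :- c) := a :- c) refl (u γ) (v γ) (w γ))
  (InOT-+ u≈v v≈w)
  where open ℚ-Solver

module ≈H-Reasoning {m : ℕ} = Relation.Binary.Reasoning.Base.Single (_≈H_ {m})
  (λ {v} → ≈H-refl {v = v}) (λ {u} {v} {w} → ≈H-trans {u = u} {v} {w})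

δₚ : ∀ {m} → Perm m → Vect m
δₚ A = δ (A ⟨$⟩ʳ_)

δ-cong : ∀ {m} {f g : Fin m → Fin m} → (∀ x → f x ≡ g x) → ∀ γ → δ f γ ≡ δ g γ
δ-cong {m} f≗g γ = cong (λ b → if b then 1ℚ else 0ℚ) (allᵇ-cong m _ _ (λ x → cong (γ x ≟ᶠ_) (f≗g x)))

-- Cycles of a permutation

module Cycles {m : ℕ} (A : Perm m) where

  iter-+ : ∀ j k x → iter A (j + k) x ≡ iter A j (iter A k x)
  iter-+ zero    k x = refl
  iter-+ (suc j) k x = cong (A ⟨$⟩ʳ_) (iter-+ j k x)

  iter-injective : ∀ k {x y} → iter A k x ≡ iter A k y → x ≡ y
  iter-injective zero    eq = eq
  iter-injective (suc k) eq = iter-injective k (trans (sym (inverseˡ A)) (trans (cong (A ⟨$⟩ˡ_) eq) (inverseˡ A)))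

  iter-* : ∀ c d x → iter A d x ≡ x → iter A (c * d) x ≡ x
  iter-* zero    d x fixed = refl
  iter-* (suc c) d x fixed = trans (iter-+ d (c * d) x) (trans (cong (iter A d) (iter-* c d x fixed)) fixed)

  period : ∀ x → ∃ λ d → iter A (suc d) x ≡ x × suc d ≤ m
  period x with FinP.pigeonhole (ℕP.n<1+n m) (λ (k : Fin (suc m)) → iter A (toℕ k) x)
  ... | i , j , i<j , Aⁱx≡Aʲx with ℕP.m≤n⇒∃[o]m+o≡n (ℕP.<⇒≤ i<j)
  ...   | zero  , i+0≡j = ⊥-elim (ℕP.<-irrefl (trans (sym (ℕP.+-identityʳ (toℕ i))) i+0≡j) i<j)
  ...   | suc d , i+d≡j = d , iter-injective (toℕ i) shifted , bound
    where
      shifted : iter A (toℕ i) (iter A (suc d) x) ≡ iter A (toℕ i) x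
      shifted = trans (sym (iter-+ (toℕ i) (suc d) x)) (trans (cong (λ k → iter A k x) i+d≡j) (sym Aⁱx≡Aʲx))
      bound : suc d ≤ m
      bound = ℕP.≤-trans (ℕP.m≤n+m (suc d) (toℕ i)) (subst (_≤ m) (sym i+d≡j) (ℕP.≤-pred (FinP.toℕ<n j)))

  iter-reduce : ∀ k x → ∃ λ (k′ : Fin m) → iter A (toℕ k′) x ≡ iter A k x
  iter-reduce k x with period x
  ... | d , fixed , d<m = Fin.fromℕ< k%<m ,
    (begin
      iter A (toℕ (Fin.fromℕ< k%<m)) x                      ≡⟨ cong (λ j → iter A j x) (FinP.toℕ-fromℕ< k%<m) ⟩
      iter A (k % suc d) x                                 ≡⟨ cong (iter A (k % suc d)) (sym (iter-* (k / suc d) (suc d) x fixed)) ⟩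
      iter A (k % suc d) (iter A (k / suc d * suc d) x)     ≡⟨ sym (iter-+ (k % suc d) (k / suc d * suc d) x) ⟩
      iter A (k % suc d + k / suc d * suc d) x             ≡⟨ cong (λ j → iter A j x) (sym (m≡m%n+[m/n]*n k (suc d))) ⟩
      iter A k x                                           ∎)
    where
      open ≡-Reasoning
      k%<m : k % suc d < m
      k%<m = ℕP.<-≤-trans (m%n<n k (suc d)) d<m

  SameCycle : Fin m → Fin m → Set
  SameCycle x y = ∃ λ k → iter A k x ≡ y

  sameCycleᵇ⁻ : ∀ x y → sameCycleᵇ A x y ≡ true → SameCycle x y
  sameCycleᵇ⁻ x y eq with anyᵇ⁻ m _ eq
  ... | k , hit = toℕ k , ≟ᶠ-true⇒≡ _ _ hit

  sameCycleᵇ⁺ : ∀ x y → SameCycle x y → sameCycleᵇ A x y ≡ true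
  sameCycleᵇ⁺ x y (k , Aᵏx≡y) with iter-reduce k x
  ... | k′ , Aᵏ′x≡Aᵏx = anyᵇ⁺ m _ k′ (subst (λ z → (iter A (toℕ k′) x ≟ᶠ z) ≡ true)
                                        (trans Aᵏ′x≡Aᵏx Aᵏx≡y) (≟ᶠ-refl (iter A (toℕ k′) x)))

  SameCycle-trans : ∀ {x y z} → SameCycle x y → SameCycle y z → SameCycle x z
  SameCycle-trans {x} (j , Aʲx≡y) (k , Aᵏy≡z) = k + j , trans (iter-+ k j x) (trans (cong (iter A k) Aʲx≡y) Aᵏy≡z)

  SameCycle-sym : ∀ {x y} → SameCycle x y → SameCycle y x
  SameCycle-sym {x} {y} (k , Aᵏx≡y) with period x
  ... | d , fixed , _ = k * suc d ∸ k ,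
    (begin
      iter A (k * suc d ∸ k) y                ≡⟨ cong (iter A (k * suc d ∸ k)) (sym Aᵏx≡y) ⟩
      iter A (k * suc d ∸ k) (iter A k x)     ≡⟨ sym (iter-+ (k * suc d ∸ k) k x) ⟩
      iter A (k * suc d ∸ k + k) x            ≡⟨ cong (λ j → iter A j x) (ℕP.m∸n+n≡m (ℕP.m≤m*n k (suc d))) ⟩
      iter A (k * suc d) x                    ≡⟨ iter-* k (suc d) x fixed ⟩
      x                                       ∎)
    where open ≡-Reasoning

  isCycleMinᵇ : Fin m → Bool
  isCycleMinᵇ r = allᵇ m (λ k → toℕ r ≤ᵇ toℕ (iter A (toℕ k) r))

  cycleMin-≤ : ∀ r → isCycleMinᵇ r ≡ true → ∀ {y} → SameCycle r y → toℕ r ≤ toℕ y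
  cycleMin-≤ r min {y} (k , Aᵏr≡y) with iter-reduce k r
  ... | k′ , Aᵏ′r≡Aᵏr = subst (λ z → toℕ r ≤ toℕ z) (trans Aᵏ′r≡Aᵏr Aᵏr≡y)
                          (≤ᵇ-true⇒≤ _ _ (allᵇ⁻ m _ min k′))

  cycleMin-unique : ∀ {r r′ q} → isCycleMinᵇ r ≡ true → isCycleMinᵇ r′ ≡ true →
                    SameCycle r q → SameCycle r′ q → r ≡ r′
  cycleMin-unique {r} {r′} min min′ r~q r′~q = FinP.toℕ-injective (ℕP.≤-antisym
    (cycleMin-≤ r min (SameCycle-trans r~q (SameCycle-sym r′~q)))
    (cycleMin-≤ r′ min′ (SameCycle-trans r′~q (SameCycle-sym r~q))))

  cycleMin : ∀ q → ∃ λ r → isCycleMinᵇ r ≡ true × SameCycle r q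
  cycleMin q with argmin q (λ k → toℕ (iter A (toℕ k) q))
  ... | k₀ , least = iter A (toℕ k₀) q , isMin , SameCycle-sym (toℕ k₀ , refl)
    where
      isMin : isCycleMinᵇ (iter A (toℕ k₀) q) ≡ true
      isMin = allᵇ⁺ m _ λ k → ≤⇒≤ᵇ-true
        (let (k′ , eq) = iter-reduce (toℕ k + toℕ k₀) q in
         subst (λ z → toℕ (iter A (toℕ k₀) q) ≤ toℕ z) (trans eq (iter-+ (toℕ k) (toℕ k₀) q)) (least k′))

-- Positions in a linear order

range : ℕ → ℕ → List ℕ
range a zero    = []
range a (suc n) = a ∷ range (suc a) n

applyUpTo-cong : ∀ n {f g : ℕ → ℕ} → (∀ i → f i ≡ g i) → applyUpTo f n ≡ applyUpTo g n
applyUpTo-cong zero    h = refl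
applyUpTo-cong (suc n) h = cong₂ _∷_ (h 0) (applyUpTo-cong n (λ i → h (suc i)))

applyUpTo-+≡range : ∀ n a → applyUpTo (a +_) n ≡ range a n
applyUpTo-+≡range zero    a = refl
applyUpTo-+≡range (suc n) a = cong₂ _∷_ (ℕP.+-identityʳ a)
  (trans (applyUpTo-cong n (λ i → ℕP.+-suc a i)) (applyUpTo-+≡range n (suc a)))

upTo≡range : ∀ n → upTo n ≡ range 0 n
upTo≡range n = applyUpTo-+≡range n 0

range-++ : ∀ j k a → range a (j + k) ≡ range a j ++ range (a + j) k
range-++ zero    k a = cong (λ b → range b k) (sym (ℕP.+-identityʳ a))
range-++ (suc j) k a = cong (a ∷_) (trans (range-++ j k (suc a))
  (cong (λ b → range (suc a) j ++ range b k) (sym (ℕP.+-suc a j))))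

All-range : ∀ n a {P : ℕ → Set} → (∀ x → a ≤ x → x < a + n → P x) → All P (range a n)
All-range zero    a h = []
All-range (suc n) a h = h a ℕP.≤-refl (ℕP.m<m+n a (s≤s z≤n)) ∷
  All-range n (suc a) (λ x a<x x<a+1+n → h x (ℕP.<⇒≤ a<x) (subst (x <_) (sym (ℕP.+-suc a n)) x<a+1+n))

All-range-≢ : ∀ n a k → (k < a ⊎ a + n ≤ k) → All (λ y → (y ≡ᵇ k) ≡ false) (range a n)
All-range-≢ n a k outside = All-range n a (λ x a≤x x<a+n → ≢⇒≡ᵇ-false x k (λ { refl →
  [ (λ k<a → ℕP.<-irrefl refl (ℕP.<-≤-trans k<a a≤x)) , (λ a+n≤k → ℕP.<-irrefl refl (ℕP.<-≤-trans x<a+n a+n≤k)) ] outside }))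

removeₗ≡ : ∀ s t → removeₗ (s + suc t) s ≡ range 0 s ++ range (suc s) t
removeₗ≡ s t = begin
    filter keep (upTo (s + suc t))
  ≡⟨ cong (filter keep) (trans (upTo≡range (s + suc t)) (range-++ s (suc t) 0)) ⟩
    filter keep (range 0 s ++ s ∷ range (suc s) t)
  ≡⟨ ListP.filter-++ keep (range 0 s) (s ∷ range (suc s) t) ⟩
    filter keep (range 0 s) ++ filter keep (s ∷ range (suc s) t)
  ≡⟨ cong₂ _++_ (ListP.filter-all keep (All-range-≢ s 0 s (inj₂ ℕP.≤-refl)))
       (trans (ListP.filter-reject keep {s} {range (suc s) t} (λ s≢s → true≢false (trans (sym (≡ᵇ-refl s)) s≢s)))
              (ListP.filter-all keep (All-range-≢ t (suc s) s (inj₁ (ℕP.n<1+n s))))) ⟩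
    range 0 s ++ range (suc s) t
  ∎
  where
    open ≡-Reasoning
    keep = λ x → (x ≡ᵇ s) Bool.≟ false

insertBefore-++ : ∀ k s xs ys → All (λ y → (y ≡ᵇ k) ≡ false) xs →
  insertBefore k s (xs ++ ys) ≡ xs ++ insertBefore k s ys
insertBefore-++ k s []       ys []           = refl
insertBefore-++ k s (x ∷ xs) ys (x≢k ∷ xs≢k) rewrite x≢k = cong (x ∷_) (insertBefore-++ k s xs ys xs≢k)

insertAfter-++ : ∀ k s xs ys → All (λ y → (y ≡ᵇ k) ≡ false) xs →
  insertAfter k s (xs ++ ys) ≡ xs ++ insertAfter k s ys
insertAfter-++ k s []       ys []           = refl
insertAfter-++ k s (x ∷ xs) ys (x≢k ∷ xs≢k) rewrite x≢k = cong (x ∷_) (insertAfter-++ k s xs ys xs≢k)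

insertBefore-head : ∀ k s ys → insertBefore k s (k ∷ ys) ≡ s ∷ k ∷ ys
insertBefore-head k s ys rewrite ≡ᵇ-refl k = refl

insertAfter-head : ∀ k s ys → insertAfter k s (k ∷ ys) ≡ k ∷ s ∷ ys
insertAfter-head k s ys rewrite ≡ᵇ-refl k = refl

insertAfter-range : ∀ u a s w → insertAfter (a + u) s (range a (suc u + w)) ≡ range a (suc u) ++ s ∷ range (a + suc u) w
insertAfter-range zero    a s w rewrite ℕP.+-identityʳ a | ≡ᵇ-refl a | ℕP.+-comm a 1 = refl
insertAfter-range (suc u) a s w =
  trans (insertAfter-++ (a + suc u) s (a ∷ []) (range (suc a) (suc u + w)) (All-range-≢ 1 a (a + suc u) (inj₂ a+1≤)))
   (cong (a ∷_) (trans (cong (λ k → insertAfter k s (range (suc a) (suc u + w))) (ℕP.+-suc a u))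
     (trans (insertAfter-range u (suc a) s w) (cong (λ b → range (suc a) (suc u) ++ s ∷ range b w) (sym (ℕP.+-suc a (suc u)))))))
  where
    a+1≤ : a + 1 ≤ a + suc u
    a+1≤ = ℕP.+-monoʳ-≤ a (s≤s z≤n)

insertAfter≡insertBefore-suc : ∀ n a k s → a ≤ k → suc k < a + n →
  insertAfter k s (range a n) ≡ insertBefore (suc k) s (range a n)
insertAfter≡insertBefore-suc zero a k s a≤k k+1<a = ⊥-elim (ℕP.<-irrefl refl
  (ℕP.<-trans (ℕP.n<1+n k) (ℕP.<-≤-trans (subst (suc k <_) (ℕP.+-identityʳ a) k+1<a) a≤k)))
insertAfter≡insertBefore-suc (suc n) a k s a≤k k+1< with a ℕ.≟ k
... | yes refl = begin
      insertAfter a s (a ∷ range (suc a) n)      ≡⟨ insertAfter-head a s _ ⟩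
      a ∷ s ∷ range (suc a) n                    ≡⟨ cong (λ ys → a ∷ s ∷ ys) (range-next n k+1<) ⟩
      a ∷ s ∷ suc a ∷ range (suc (suc a)) (n ∸ 1) ≡⟨ cong (a ∷_) (sym (insertBefore-head (suc a) s _)) ⟩
      a ∷ insertBefore (suc a) s (suc a ∷ range (suc (suc a)) (n ∸ 1))
          ≡⟨ cong (λ ys → a ∷ insertBefore (suc a) s ys) (sym (range-next n k+1<)) ⟩
      a ∷ insertBefore (suc a) s (range (suc a) n)
          ≡⟨ sym (insertBefore-++ (suc a) s (a ∷ []) _ (All-range-≢ 1 a (suc a) (inj₂ (ℕP.≤-reflexive (ℕP.+-comm a 1))))) ⟩
      insertBefore (suc a) s (a ∷ range (suc a) n) ∎
  where
    open ≡-Reasoning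
    range-next : ∀ n → suc a < a + suc n → range (suc a) n ≡ suc a ∷ range (suc (suc a)) (n ∸ 1)
    range-next zero    a+1<a+1 = ⊥-elim (ℕP.<-irrefl refl (subst (suc a <_) (ℕP.+-comm a 1) a+1<a+1))
    range-next (suc n) _       = refl
... | no a≢k = begin
      insertAfter k s (a ∷ range (suc a) n)
           ≡⟨ insertAfter-++ k s (a ∷ []) (range (suc a) n) (≢⇒≡ᵇ-false a k a≢k ∷ []) ⟩
      a ∷ insertAfter k s (range (suc a) n)
           ≡⟨ cong (a ∷_) (insertAfter≡insertBefore-suc n (suc a) k s (ℕP.≤∧≢⇒< a≤k a≢k) (subst (suc k <_) (ℕP.+-suc a n) k+1<)) ⟩
      a ∷ insertBefore (suc k) s (range (suc a) n)
           ≡⟨ sym (insertBefore-++ (suc k) s (a ∷ []) (range (suc a) n)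
                 (≢⇒≡ᵇ-false a (suc k) (λ a≡k+1 → ℕP.<-irrefl a≡k+1 (s≤s a≤k)) ∷ [])) ⟩
      insertBefore (suc k) s (a ∷ range (suc a) n) ∎
  where open ≡-Reasoning

indexOf-head : ∀ x ys → indexOf x (x ∷ ys) ≡ 0
indexOf-head x ys rewrite ≡ᵇ-refl x = refl

indexOf-tail : ∀ x y ys → x ≢ y → indexOf x (y ∷ ys) ≡ suc (indexOf x ys)
indexOf-tail x y ys x≢y rewrite ≢⇒≡ᵇ-false x y x≢y = refl

indexOf-range : ∀ n a i ys → i < n → indexOf (a + i) (range a n ++ ys) ≡ i
indexOf-range (suc n) a zero    ys _ rewrite ℕP.+-identityʳ a = indexOf-head a (range (suc a) n ++ ys)
indexOf-range (suc n) a (suc i) ys (s≤s i<n) =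
  trans (indexOf-tail (a + suc i) a (range (suc a) n ++ ys) (λ eq → ℕP.<-irrefl (sym eq) (ℕP.m<m+n a (s≤s z≤n))))
        (cong suc (trans (cong (λ z → indexOf z (range (suc a) n ++ ys)) (ℕP.+-suc a i)) (indexOf-range n (suc a) i ys i<n)))

indexOf-range-outside : ∀ n a x ys → (x < a ⊎ a + n ≤ x) → indexOf x (range a n ++ ys) ≡ n + indexOf x ys
indexOf-range-outside zero    a x ys outside = refl
indexOf-range-outside (suc n) a x ys outside =
  trans (indexOf-tail x a (range (suc a) n ++ ys) x≢a) (cong suc (indexOf-range-outside n (suc a) x ys outside′))
  where
    x≢a : x ≢ a
    x≢a refl = [ (λ x<x → ℕP.<-irrefl refl x<x) , (λ a+n≤a → ℕP.<-irrefl refl (ℕP.<-≤-trans (ℕP.m<m+n a (s≤s z≤n)) a+n≤a)) ] outside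
    outside′ : x < suc a ⊎ suc a + n ≤ x
    outside′ = Sum.map ℕP.m<n⇒m<1+n (subst (_≤ x) (ℕP.+-suc a n)) outside

-- the relabelling of α^{s→(e-1)⁺}: s goes to e - 1, the rest of [s, e) moves down
rotateBlock : ℕ → ℕ → ℕ → ℕ
rotateBlock s e x = if x <ᵇ s then x else if x ≡ᵇ s then e ∸ 1 else if x <ᵇ e then x ∸ 1 else x

rotateBlock-below : ∀ s e x → x < s → rotateBlock s e x ≡ x
rotateBlock-below s e x x<s rewrite <⇒<ᵇ-true x<s = refl

rotateBlock-start : ∀ s e → rotateBlock s e s ≡ e ∸ 1
rotateBlock-start s e rewrite ≥⇒<ᵇ-false (ℕP.≤-refl {s}) | ≡ᵇ-refl s = refl

rotateBlock-inside : ∀ s e x → s < x → x < e → rotateBlock s e x ≡ x ∸ 1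
rotateBlock-inside s e x s<x x<e
  rewrite ≥⇒<ᵇ-false (ℕP.<⇒≤ s<x) | ≢⇒≡ᵇ-false x s (λ x≡s → ℕP.<-irrefl (sym x≡s) s<x) | <⇒<ᵇ-true x<e = refl

rotateBlock-above : ∀ s e x → s < e → e ≤ x → rotateBlock s e x ≡ x
rotateBlock-above s e x s<e e≤x
  rewrite ≥⇒<ᵇ-false (ℕP.<⇒≤ (ℕP.<-≤-trans s<e e≤x))
        | ≢⇒≡ᵇ-false x s (λ x≡s → ℕP.<-irrefl (sym x≡s) (ℕP.<-≤-trans s<e e≤x)) | ≥⇒<ᵇ-false e≤x = refl

rotateBlock-singleton : ∀ s x → rotateBlock s (suc s) x ≡ x
rotateBlock-singleton s x with ℕP.<-cmp x s
... | tri< x<s _ _ = rotateBlock-below s (suc s) x x<s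
... | tri≈ _ refl _ = rotateBlock-start x (suc x)
... | tri> _ _ s<x = rotateBlock-above s (suc s) x (ℕP.n<1+n s) s<x

rotateBlock-+ : ∀ a n t → t < suc n → rotateBlock a (a + suc n) (a + t) ≡ a + rotateBlock 0 (suc n) t
rotateBlock-+ a n zero _ rewrite ℕP.+-identityʳ a | rotateBlock-start a (a + suc n) | ℕP.+-suc a n = refl
rotateBlock-+ a n (suc t) (s≤s t<n) =
  trans (rotateBlock-inside a (a + suc n) (a + suc t) (ℕP.m<m+n a (s≤s z≤n)) (ℕP.+-monoʳ-< a (s≤s t<n)))
   (trans (cong (_∸ 1) (ℕP.+-suc a t)) (cong (a +_) (sym (rotateBlock-inside 0 (suc n) (suc t) (s≤s z≤n) (s≤s t<n)))))

rotateBlock-surjective : ∀ m s e → s < e → e ≤ m → (y : Fin m) → ∃ λ (x : Fin m) → toℕ y ≡ rotateBlock s e (toℕ x)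
rotateBlock-surjective m s e s<e e≤m y with toℕ y ℕ.<? s
... | yes y<s = y , sym (rotateBlock-below s e (toℕ y) y<s)
... | no y≮s with toℕ y ℕ.<? e
...   | no y≮e = y , sym (rotateBlock-above s e (toℕ y) s<e (ℕP.≮⇒≥ y≮e))
...   | yes y<e with suc (toℕ y) ℕ.≟ e
...     | yes y+1≡e = Fin.fromℕ< s<m ,
            trans (cong (_∸ 1) y+1≡e) (trans (sym (rotateBlock-start s e)) (cong (rotateBlock s e) (sym (FinP.toℕ-fromℕ< s<m))))
  where
    s<m : s < m
    s<m = ℕP.<-≤-trans s<e e≤m
...     | no y+1≢e = Fin.fromℕ< y+1<m ,
            trans (sym (rotateBlock-inside s e (suc (toℕ y)) (s≤s (ℕP.≮⇒≥ y≮s)) y+1<e))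
                  (cong (rotateBlock s e) (sym (FinP.toℕ-fromℕ< y+1<m)))
  where
    y+1<e : suc (toℕ y) < e
    y+1<e = ℕP.≤∧≢⇒< y<e y+1≢e
    y+1<m : suc (toℕ y) < m
    y+1<m = ℕP.<-≤-trans y+1<e e≤m

orderBefore orderAfter : ℕ → ℕ → ℕ → List ℕ
orderBefore m s k = insertBefore k s (removeₗ m s)
orderAfter  m s k = insertAfter  k s (removeₗ m s)

private
  removeₗ≡′ : ∀ {m} s t → m ≡ s + suc t → removeₗ m s ≡ range 0 s ++ range (suc s) t
  removeₗ≡′ s t refl = removeₗ≡ s t

  All-range-below : ∀ s k → s < k → All (λ y → (y ≡ᵇ k) ≡ false) (range 0 s)
  All-range-below s k s<k = All-range-≢ s 0 k (inj₂ (ℕP.<⇒≤ s<k))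

indexOf-orderBefore-next : ∀ m s t x → m ≡ s + suc (suc t) → x < m → indexOf x (orderBefore m s (suc s)) ≡ x
indexOf-orderBefore-next m s t x m≡ x<m = begin
    indexOf x (insertBefore (suc s) s (removeₗ m s))
  ≡⟨ cong (λ xs → indexOf x (insertBefore (suc s) s xs)) (removeₗ≡′ s (suc t) m≡) ⟩
    indexOf x (insertBefore (suc s) s (range 0 s ++ range (suc s) (suc t)))
  ≡⟨ cong (indexOf x) (insertBefore-++ (suc s) s (range 0 s) _ (All-range-below s (suc s) (ℕP.n<1+n s))) ⟩
    indexOf x (range 0 s ++ insertBefore (suc s) s (suc s ∷ range (suc (suc s)) t))
  ≡⟨ cong (λ xs → indexOf x (range 0 s ++ xs)) (insertBefore-head (suc s) s _) ⟩
    indexOf x (range 0 s ++ range s (suc (suc t)))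
  ≡⟨ cong (indexOf x) (trans (sym (range-++ s (suc (suc t)) 0)) (sym (ListP.++-identityʳ _))) ⟩
    indexOf (0 + x) (range 0 (s + suc (suc t)) ++ [])
  ≡⟨ indexOf-range (s + suc (suc t)) 0 x [] (subst (x <_) m≡ x<m) ⟩
    x
  ∎
  where open ≡-Reasoning

orderAfter≡orderBefore-suc : ∀ m s t k → m ≡ s + suc t → s < k → suc k < m →
  orderAfter m s k ≡ orderBefore m s (suc k)
orderAfter≡orderBefore-suc m s t k m≡ s<k k+1<m = begin
    insertAfter k s (removeₗ m s)
  ≡⟨ cong (insertAfter k s) (removeₗ≡′ s t m≡) ⟩
    insertAfter k s (range 0 s ++ range (suc s) t)
  ≡⟨ insertAfter-++ k s (range 0 s) _ (All-range-below s k s<k) ⟩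
    range 0 s ++ insertAfter k s (range (suc s) t)
  ≡⟨ cong (range 0 s ++_) (insertAfter≡insertBefore-suc t (suc s) k s s<k (subst (suc k <_) (trans m≡ (ℕP.+-suc s t)) k+1<m)) ⟩
    range 0 s ++ insertBefore (suc k) s (range (suc s) t)
  ≡⟨ sym (insertBefore-++ (suc k) s (range 0 s) _ (All-range-below s (suc k) (ℕP.m<n⇒m<1+n s<k))) ⟩
    insertBefore (suc k) s (range 0 s ++ range (suc s) t)
  ≡⟨ cong (insertBefore (suc k) s) (sym (removeₗ≡′ s t m≡)) ⟩
    insertBefore (suc k) s (removeₗ m s)
  ∎
  where open ≡-Reasoning

private
  orderAfter-last≡ : ∀ m s u w → m ≡ s + suc (suc u + w) →
    orderAfter m s (suc s + u) ≡ range 0 s ++ (range (suc s) (suc u) ++ s ∷ range (suc s + suc u) w)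
  orderAfter-last≡ m s u w m≡ = begin
      insertAfter (suc s + u) s (removeₗ m s)
    ≡⟨ cong (insertAfter (suc s + u) s) (removeₗ≡′ s (suc u + w) m≡) ⟩
      insertAfter (suc s + u) s (range 0 s ++ range (suc s) (suc u + w))
    ≡⟨ insertAfter-++ (suc s + u) s (range 0 s) _ (All-range-below s (suc s + u) (s≤s (ℕP.m≤m+n s u))) ⟩
      range 0 s ++ insertAfter (suc s + u) s (range (suc s) (suc u + w))
    ≡⟨ cong (range 0 s ++_) (insertAfter-range u (suc s) s w) ⟩
      range 0 s ++ (range (suc s) (suc u) ++ s ∷ range (suc s + suc u) w)
    ∎
    where open ≡-Reasoning

  indexOf-orderAfter-above : ∀ s u w x → suc s + suc u ≤ x → x < s + suc (suc u + w) →
    indexOf x (range 0 s ++ (range (suc s) (suc u) ++ s ∷ range (suc s + suc u) w)) ≡ x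
  indexOf-orderAfter-above s u w x e≤x x<m with ℕP.m≤n⇒∃[o]m+o≡n e≤x
  ... | i , refl = begin
      indexOf x (range 0 s ++ (range (suc s) (suc u) ++ s ∷ range (suc s + suc u) w))
    ≡⟨ indexOf-range-outside s 0 x _ (inj₂ (ℕP.≤-trans (ℕP.m≤m+n s (suc u)) (ℕP.≤-trans (ℕP.n≤1+n _) e≤x))) ⟩
      s + indexOf x (range (suc s) (suc u) ++ s ∷ range (suc s + suc u) w)
    ≡⟨ cong (s +_) (indexOf-range-outside (suc u) (suc s) x _ (inj₂ e≤x)) ⟩
      s + (suc u + indexOf x (s ∷ range (suc s + suc u) w))
    ≡⟨ cong (λ z → s + (suc u + z)) (indexOf-tail x s (range (suc s + suc u) w) (λ x≡s → ℕP.<-irrefl (sym x≡s) s<x)) ⟩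
      s + (suc u + suc (indexOf x (range (suc s + suc u) w)))
    ≡⟨ cong (λ ys → s + (suc u + suc (indexOf x ys))) (sym (ListP.++-identityʳ (range (suc s + suc u) w))) ⟩
      s + (suc u + suc (indexOf (suc s + suc u + i) (range (suc s + suc u) w ++ [])))
    ≡⟨ cong (λ z → s + (suc u + suc z)) (indexOf-range w (suc s + suc u) i [] i<w) ⟩
      s + (suc u + suc i)
    ≡⟨ solve 3 (λ s u i → s :+ (con 1 :+ u :+ (con 1 :+ i)) := con 1 :+ s :+ (con 1 :+ u) :+ i) refl s u i ⟩
      suc s + suc u + i
    ∎
    where
      open ≡-Reasoning
      open ℕ-Solver
      s<x : s < suc s + suc u + i
      s<x = ℕP.<-≤-trans (ℕP.n<1+n s) (ℕP.≤-trans (ℕP.m≤m+n (suc s) (suc u)) (ℕP.m≤m+n _ i))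
      i<w : i < w
      i<w = ℕP.+-cancelˡ-< (suc s + suc u) i w (subst (suc s + suc u + i <_)
              (solve 3 (λ s u w → s :+ (con 1 :+ (con 1 :+ u :+ w)) := con 1 :+ s :+ (con 1 :+ u) :+ w) refl s u w) x<m)

indexOf-orderAfter-last : ∀ m s u w x → m ≡ s + suc (suc u + w) → x < m →
  indexOf x (orderAfter m s (suc s + u)) ≡ rotateBlock s (suc (suc s + u)) x
indexOf-orderAfter-last m s u w x m≡ x<m rewrite orderAfter-last≡ m s u w m≡ with ℕP.<-cmp x s
... | tri< x<s _ _ = trans (indexOf-range s 0 x _ x<s) (sym (rotateBlock-below s e x x<s))
  where e = suc (suc s + u)
... | tri≈ _ refl _ = begin
    indexOf x (range 0 x ++ (range (suc x) (suc u) ++ x ∷ range (suc x + suc u) w))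
  ≡⟨ indexOf-range-outside x 0 x _ (inj₂ ℕP.≤-refl) ⟩
    x + indexOf x (range (suc x) (suc u) ++ x ∷ range (suc x + suc u) w)
  ≡⟨ cong (x +_) (indexOf-range-outside (suc u) (suc x) x _ (inj₁ (ℕP.n<1+n x))) ⟩
    x + (suc u + indexOf x (x ∷ range (suc x + suc u) w))
  ≡⟨ cong (λ z → x + (suc u + z)) (indexOf-head x (range (suc x + suc u) w)) ⟩
    x + (suc u + 0)
  ≡⟨ trans (cong (x +_) (ℕP.+-identityʳ (suc u))) (ℕP.+-suc x u) ⟩
    suc (suc x + u) ∸ 1
  ≡⟨ sym (rotateBlock-start x (suc (suc x + u))) ⟩
    rotateBlock x (suc (suc x + u)) x
  ∎
  where open ≡-Reasoning
... | tri> _ _ s<x with ℕP.<-cmp x (suc (suc s + u))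
...   | tri< x<e _ _ with ℕP.m≤n⇒∃[o]m+o≡n s<x
...     | i , refl =
  trans (indexOf-range-outside s 0 (suc s + i) _ (inj₂ (ℕP.≤-trans (ℕP.n≤1+n s) (ℕP.m≤m+n (suc s) i))))
   (trans (cong (s +_) (indexOf-range (suc u) (suc s) i _ (ℕP.+-cancelˡ-< (suc s) i (suc u)
           (subst (suc s + i <_) (sym (ℕP.+-suc (suc s) u)) x<e))))
     (sym (rotateBlock-inside s (suc (suc s + u)) (suc s + i) s<x x<e)))
indexOf-orderAfter-last m s u w x m≡ x<m | tri> _ _ s<x | tri≈ _ refl _ =
  trans (indexOf-orderAfter-above s u w x (ℕP.≤-reflexive (ℕP.+-suc (suc s) u)) (subst (x <_) m≡ x<m))
        (sym (rotateBlock-above s x x (ℕP.<-trans (ℕP.n<1+n s) (s≤s (s≤s (ℕP.m≤m+n s u)))) ℕP.≤-refl))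
indexOf-orderAfter-last m s u w x m≡ x<m | tri> _ _ s<x | tri> _ _ e<x =
  trans (indexOf-orderAfter-above s u w x (subst (_≤ x) (sym (ℕP.+-suc (suc s) u)) (ℕP.<⇒≤ e<x)) (subst (x <_) m≡ x<m))
        (sym (rotateBlock-above s (suc (suc s + u)) x (ℕP.<-trans (ℕP.n<1+n s) (s≤s (s≤s (ℕP.m≤m+n s u)))) (ℕP.<⇒≤ e<x)))

-- G = φ ∘ A ∘ φ⁻¹, for φ a relabelling of the points by positions
Conjugate : ∀ {m} → (Fin m → ℕ) → Perm m → (Fin m → Fin m) → Set
Conjugate φ A G = ∀ x y → toℕ y ≡ φ x → toℕ (G y) ≡ φ (A ⟨$⟩ʳ x)

δConj≡δ : ∀ {m} (φ : Fin m → ℕ) (A : Perm m) (G : Fin m → Fin m) →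
  (∀ y → ∃ λ x → toℕ y ≡ φ x) → Conjugate φ A G → ∀ γ → δConj φ A γ ≡ δ G γ
δConj≡δ {m} φ A G φ-onto G-conj γ =
  cong (λ b → if b then 1ℚ else 0ℚ) (true⇔⇒≡ _ _ graph⇒pointwise pointwise⇒graph)
  where
    agrees : Fin m → Fin m → Bool
    agrees x y = not (toℕ y ≡ᵇ φ x) ∨ (toℕ (γ y) ≡ᵇ φ (A ⟨$⟩ʳ x))

    implies : ∀ b {c} → b ≡ true → (not b ∨ c) ≡ true → c ≡ true
    implies true refl h = h

    graph⇒pointwise : allᵇ m (λ x → allᵇ m (agrees x)) ≡ true → allᵇ m (λ y → γ y ≟ᶠ G y) ≡ true
    graph⇒pointwise h = allᵇ⁺ m _ λ y →
      let (x , y≡φx) = φ-onto y in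
      ≡⇒≡ᵇ-true (toℕ (γ y)) (toℕ (G y))
        (trans (≡ᵇ-true⇒≡ _ _ (implies _ (≡⇒≡ᵇ-true _ _ y≡φx) (allᵇ⁻ m _ (allᵇ⁻ m _ h x) y)))
               (sym (G-conj x y y≡φx)))

    agrees-if : allᵇ m (λ y → γ y ≟ᶠ G y) ≡ true → ∀ x y b → (toℕ y ≡ᵇ φ x) ≡ b →
                (not b ∨ (toℕ (γ y) ≡ᵇ φ (A ⟨$⟩ʳ x))) ≡ true
    agrees-if h x y false _ = refl
    agrees-if h x y true y≡φx = ≡⇒≡ᵇ-true _ _
      (trans (cong toℕ (≟ᶠ-true⇒≡ (γ y) (G y) (allᵇ⁻ m _ h y))) (G-conj x y (≡ᵇ-true⇒≡ _ _ y≡φx)))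

    pointwise⇒graph : allᵇ m (λ y → γ y ≟ᶠ G y) ≡ true → allᵇ m (λ x → allᵇ m (agrees x)) ≡ true
    pointwise⇒graph h = allᵇ⁺ m _ λ x → allᵇ⁺ m _ λ y → agrees-if h x y _ refl

-- Moving the first leg of a closed block to its end

InBlock : ℕ → ℕ → ℕ → Set
InBlock s e k = s ≤ k × k < e

inBlockᵇ : ℕ → ℕ → ℕ → Bool
inBlockᵇ s e k = (s ≤ᵇ k) ∧ (k <ᵇ e)

inBlockᵇ⁻ : ∀ s e k → inBlockᵇ s e k ≡ true → InBlock s e k
inBlockᵇ⁻ s e k eq = ≤ᵇ-true⇒≤ s k (∧-trueˡ {s ≤ᵇ k} eq) , <ᵇ-true⇒< k e (∧-trueʳ {s ≤ᵇ k} eq)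

inBlockᵇ⁺ : ∀ {s e k} → InBlock s e k → inBlockᵇ s e k ≡ true
inBlockᵇ⁺ (s≤k , k<e) = ∧-true (≤⇒≤ᵇ-true s≤k) (<⇒<ᵇ-true k<e)

Closed : ∀ {m} → Perm m → ℕ → ℕ → Set
Closed A s e = ∀ x → InBlock s e (toℕ x) → InBlock s e (toℕ (A ⟨$⟩ʳ x))

module BlockMove {m : ℕ} (A : Perm m) (p : Fin m) (e : ℕ) (p<e : toℕ p < e) (closed : Closed A (toℕ p) e) where

  open Cycles A

  s : ℕ
  s = toℕ p

  inB : Fin m → Bool
  inB x = inBlockᵇ s e (toℕ x)

  InBlock-iter : ∀ k {x} → InBlock s e (toℕ x) → InBlock s e (toℕ (iter A k x))
  InBlock-iter zero    x∈B = x∈B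
  InBlock-iter (suc k) x∈B = closed _ (InBlock-iter k x∈B)

  inB-SameCycle : ∀ {x y} → inB x ≡ true → SameCycle x y → inB y ≡ true
  inB-SameCycle {x} x∈B (k , refl) = inBlockᵇ⁺ (InBlock-iter k (inBlockᵇ⁻ s e (toℕ x) x∈B))

  inB-p : inB p ≡ true
  inB-p = inBlockᵇ⁺ (ℕP.≤-refl , p<e)

  -- the cycles of the block other than that of p, each listed once through its least leg
  isOtherCycleMin : Fin m → Bool
  isOtherCycleMin r = inB r ∧ (isCycleMinᵇ r ∧ not (sameCycleᵇ A r p))

  otherCycleMin-≁p : ∀ r → isOtherCycleMin r ≡ true → sameCycleᵇ A r p ≡ false
  otherCycleMin-≁p r h with sameCycleᵇ A r p
  ... | true  = ⊥-elim (true≢false (trans (sym (∧-trueʳ {inB r} h)) (∧-zeroʳ (isCycleMinᵇ r))))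
  ... | false = refl

  otherCycleMin-inB : ∀ r → isOtherCycleMin r ≡ true → inB r ≡ true
  otherCycleMin-inB r h = ∧-trueˡ {inB r} h

  otherCycleMin-min : ∀ r → isOtherCycleMin r ≡ true → isCycleMinᵇ r ≡ true
  otherCycleMin-min r h = ∧-trueˡ {isCycleMinᵇ r} (∧-trueʳ {inB r} h)

  -- Every leg q ≠ p of the block lies either on the cycle of p or on the cycle of
  -- exactly one other cycle minimum.
  module Partition (M : Fin m → ℚ) where

    inCycleOfP : Fin m → ℚ
    inCycleOfP q = if sameCycleᵇ A p q ∧ not (q ≟ᶠ p) then M q else 0ℚ

    inCycleOf : Fin m → Fin m → ℚ
    inCycleOf r q = if isOtherCycleMin r then (if sameCycleᵇ A r q then M q else 0ℚ) else 0ℚ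

    inBlockNotP : Fin m → ℚ
    inBlockNotP q = if inB q ∧ not (q ≟ᶠ p) then M q else 0ℚ

    covered-once : ∀ q → inCycleOfP q ⊕ ΣFin m (λ r → inCycleOf r q) ≡ inBlockNotP q
    covered-once q with q ≟ᶠ p in q≟p
    ... | true = trans (cong₂ _⊕_ (if-false (∧-zeroʳ (sameCycleᵇ A p q))) (ΣFin-zero m none))
                       (sym (if-false (∧-zeroʳ (inB q))))
      where
        none : ∀ r → inCycleOf r q ≡ 0ℚ
        none r with isOtherCycleMin r in rmin
        ... | false = refl
        ... | true  = if-false (trans (cong (sameCycleᵇ A r) (≟ᶠ-true⇒≡ q p q≟p)) (otherCycleMin-≁p r rmin))
    ... | false rewrite ∧-identityʳ (sameCycleᵇ A p q) | ∧-identityʳ (inB q) with sameCycleᵇ A p q in p~q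
    ...   | true rewrite inB-SameCycle inB-p (sameCycleᵇ⁻ p q p~q) =
            trans (cong (M q ⊕_) (ΣFin-zero m none)) (ℚP.+-identityʳ (M q))
      where
        none : ∀ r → inCycleOf r q ≡ 0ℚ
        none r with isOtherCycleMin r in rmin
        ... | false = refl
        ... | true with sameCycleᵇ A r q in r~q
        ...   | false = refl
        ...   | true  = ⊥-elim (true≢false (trans
                  (sym (sameCycleᵇ⁺ r p (SameCycle-trans (sameCycleᵇ⁻ r q r~q) (SameCycle-sym (sameCycleᵇ⁻ p q p~q)))))
                  (otherCycleMin-≁p r rmin)))
    ...   | false with inB q in q∈B
    ...     | false = trans (ℚP.+-identityˡ _) (ΣFin-zero m none)
      where
        none : ∀ r → inCycleOf r q ≡ 0ℚ
        none r with isOtherCycleMin r in rmin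
        ... | false = refl
        ... | true with sameCycleᵇ A r q in r~q
        ...   | false = refl
        ...   | true  = ⊥-elim (true≢false (trans (sym (inB-SameCycle (otherCycleMin-inB r rmin) (sameCycleᵇ⁻ r q r~q))) q∈B))
    ...     | true with cycleMin q
    ...       | r₀ , r₀-min , r₀~q = trans (ℚP.+-identityˡ _) (trans (ΣFin-single m _ r₀ only-r₀) at-r₀)
      where
        r₀≁p : sameCycleᵇ A r₀ p ≡ false
        r₀≁p = ¬-not λ r₀~p → true≢false (trans
                 (sym (sameCycleᵇ⁺ p q (SameCycle-trans (SameCycle-sym (sameCycleᵇ⁻ r₀ p r₀~p)) r₀~q))) p~q)
        r₀-other : isOtherCycleMin r₀ ≡ true
        r₀-other = ∧-true (inB-SameCycle q∈B (SameCycle-sym r₀~q)) (∧-true r₀-min (not-false r₀≁p))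
        at-r₀ : inCycleOf r₀ q ≡ M q
        at-r₀ rewrite r₀-other | sameCycleᵇ⁺ r₀ q r₀~q = refl
        only-r₀ : ∀ r → r ≢ r₀ → inCycleOf r q ≡ 0ℚ
        only-r₀ r r≢r₀ with isOtherCycleMin r in rmin
        ... | false = refl
        ... | true with sameCycleᵇ A r q in r~q
        ...   | false = refl
        ...   | true  = ⊥-elim (r≢r₀ (cycleMin-unique (otherCycleMin-min r rmin) r₀-min (sameCycleᵇ⁻ r q r~q) r₀~q))

    Σ-covered-once : ΣFin m inCycleOfP ⊕ ΣFin m (λ r → if isOtherCycleMin r then ΣFin m (λ q → if sameCycleᵇ A r q then M q else 0ℚ) else 0ℚ)
                     ≡ ΣFin m inBlockNotP
    Σ-covered-once = begin
        ΣFin m inCycleOfP ⊕ ΣFin m (λ r → if isOtherCycleMin r then ΣFin m (λ q → if sameCycleᵇ A r q then M q else 0ℚ) else 0ℚ)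
      ≡⟨ cong (ΣFin m inCycleOfP ⊕_) (ΣFin-cong m (λ r → ΣFin-if (isOtherCycleMin r) m _)) ⟩
        ΣFin m inCycleOfP ⊕ ΣFin m (λ r → ΣFin m (inCycleOf r))
      ≡⟨ cong (ΣFin m inCycleOfP ⊕_) (ΣFin-comm m m inCycleOf) ⟩
        ΣFin m inCycleOfP ⊕ ΣFin m (λ q → ΣFin m (λ r → inCycleOf r q))
      ≡⟨ sym (ΣFin-+ m inCycleOfP _) ⟩
        ΣFin m (λ q → inCycleOfP q ⊕ ΣFin m (λ r → inCycleOf r q))
      ≡⟨ ΣFin-cong m covered-once ⟩
        ΣFin m inBlockNotP
      ∎
      where open ≡-Reasoning

  oneAndTwoArcs : Vect m
  oneAndTwoArcs γ = oneArc A p γ ⊕ ΣFin m (λ r → if isOtherCycleMin r then twoArc A p r γ else 0ℚ)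

  oneAndTwoArcs-InOT : InOT m oneAndTwoArcs
  oneAndTwoArcs-InOT = InOT-+ (InOT-gen (one A p)) (InOT-ΣFin m _ twoArc-InOT)
    where
      twoArc-InOT : ∀ r → InOT m (λ γ → if isOtherCycleMin r then twoArc A p r γ else 0ℚ)
      twoArc-InOT r with isOtherCycleMin r in rmin
      ... | true  = InOT-gen (two A p r (otherCycleMin-≁p r rmin))
      ... | false = InOT-zero

  movesInBlock : Vect m
  movesInBlock γ = ΣFin m (λ q → if inB q ∧ not (q ≟ᶠ p) then δMove A p q γ else 0ℚ)

  oneAndTwoArcs≡movesInBlock : ∀ γ → oneAndTwoArcs γ ≡ movesInBlock γ
  oneAndTwoArcs≡movesInBlock γ = Partition.Σ-covered-once (λ q → δMove A p q γ)

-- α^{p→k⁺} = α^{p→(k+1)⁻} strictly inside the block [s, e), so the moves telescope.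
module Telescope {m : ℕ} (A : Perm m) (p : Fin m) (u w : ℕ) (m≡ : m ≡ toℕ p + suc (suc u + w))
                 (γ : Fin m → Fin m) where

  s e : ℕ
  s = toℕ p
  e = suc (suc s + u)

  s+1<e : suc s < e
  s+1<e = s≤s (s≤s (ℕP.m≤m+n s u))

  e≤m : e ≤ m
  e≤m = subst (e ≤_) (sym m≡) (ℕP.≤-trans (ℕP.m≤m+n e w)
          (ℕP.≤-reflexive (solve 3 (λ s u w → con 2 :+ s :+ u :+ w := s :+ (con 2 :+ u :+ w)) refl s u w)))
    where open ℕ-Solver

  D⁻ D⁺ : ℕ → ℚ
  D⁻ k = δConj (λ x → indexOf (toℕ x) (orderBefore m s k)) A γ
  D⁺ k = δConj (λ x → indexOf (toℕ x) (orderAfter  m s k)) A γ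

  D⁺≡D⁻-suc : ∀ k → s < k → suc k < e → D⁺ k ≡ D⁻ (suc k)
  D⁺≡D⁻-suc k s<k k+1<e = cong (λ xs → δConj (λ x → indexOf (toℕ x) xs) A γ)
    (orderAfter≡orderBefore-suc m s (suc u + w) k m≡ s<k (ℕP.<-≤-trans k+1<e e≤m))

  -- agrees with D⁻ strictly inside the block, and with D⁺ (e - 1) at e
  X : ℕ → ℚ
  X k = if k ≡ᵇ suc s then D⁻ (suc s) else D⁺ (k ∸ 1)

  X≡D⁻ : ∀ k → s < k → k < e → X k ≡ D⁻ k
  X≡D⁻ (suc k) s<k+1 k+1<e with k ℕ.≟ s
  ... | yes refl = if-true (≡ᵇ-refl (suc k))
  ... | no  k≢s  = trans (if-false (≢⇒≡ᵇ-false (suc k) (suc s) (k≢s ∘′ ℕP.suc-injective)))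
                         (D⁺≡D⁻-suc k (ℕP.≤∧≢⇒< (ℕP.≤-pred s<k+1) (k≢s ∘′ sym)) k+1<e)

  move : ℕ → ℚ
  move k = if inBlockᵇ s e k ∧ not (k ≡ᵇ s) then D⁻ k ⊖ D⁺ k else 0ℚ

  move≡differenceOn : ∀ k → move k ≡ differenceOn (suc s) e X k
  move≡differenceOn k with ℕP.<-cmp k s
  ... | tri< k<s _ _ rewrite >⇒≤ᵇ-false k<s | >⇒≤ᵇ-false (ℕP.m<n⇒m<1+n k<s) = refl
  ... | tri≈ _ refl _ rewrite ≡ᵇ-refl k | ∧-zeroʳ ((k ≤ᵇ k) ∧ (k <ᵇ e)) | >⇒≤ᵇ-false (ℕP.n<1+n k) = refl
  ... | tri> _ _ s<k with k ℕ.<? e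
  ...   | no k≮e rewrite ≤⇒≤ᵇ-true (ℕP.<⇒≤ s<k) | ≥⇒<ᵇ-false (ℕP.≮⇒≥ k≮e) | ≤⇒≤ᵇ-true s<k = refl
  ...   | yes k<e rewrite ≤⇒≤ᵇ-true (ℕP.<⇒≤ s<k) | <⇒<ᵇ-true k<e | ≢⇒≡ᵇ-false k s (λ k≡s → ℕP.<-irrefl (sym k≡s) s<k)
                        | ≤⇒≤ᵇ-true s<k =
    cong (_⊖ D⁺ k) (sym (X≡D⁻ k s<k k<e))

  Σ-move : ΣFin m (λ q → move (toℕ q)) ≡ D⁻ (suc s) ⊖ D⁺ (e ∸ 1)
  Σ-move = begin
      ΣFin m (λ q → move (toℕ q))            ≡⟨ ΣFin-toℕ m move ⟩
      Σℕ m move                              ≡⟨ Σℕ-cong m move≡differenceOn ⟩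
      Σℕ m (differenceOn (suc s) e X)        ≡⟨ Σℕ-telescope m (suc s) e X (ℕP.<⇒≤ s+1<e) e≤m ⟩
      X (suc s) ⊖ X e                        ≡⟨ cong₂ _⊖_ (if-true (≡ᵇ-refl s)) (if-false (≢⇒≡ᵇ-false e (suc s) e≢s+1)) ⟩
      D⁻ (suc s) ⊖ D⁺ (e ∸ 1)                ∎
    where
      open ≡-Reasoning
      e≢s+1 : e ≢ suc s
      e≢s+1 e≡s+1 = ℕP.<-irrefl (sym e≡s+1) s+1<e

  D⁻-first : D⁻ (suc s) ≡ δ (A ⟨$⟩ʳ_) γ
  D⁻-first = δConj≡δ _ A (A ⟨$⟩ʳ_) (λ y → y , sym (identity y)) A-conj γ
    where
      identity : ∀ x → indexOf (toℕ x) (orderBefore m s (suc s)) ≡ toℕ x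
      identity x = indexOf-orderBefore-next m s (u + w) (toℕ x) m≡ (FinP.toℕ<n x)
      A-conj : Conjugate (λ x → indexOf (toℕ x) (orderBefore m s (suc s))) A (A ⟨$⟩ʳ_)
      A-conj x y y≡ = trans (cong (λ z → toℕ (A ⟨$⟩ʳ z)) (FinP.toℕ-injective (trans y≡ (identity x))))
                            (sym (identity (A ⟨$⟩ʳ x)))

  D⁺-last : (G : Fin m → Fin m) → Conjugate (λ x → rotateBlock s e (toℕ x)) A G → D⁺ (e ∸ 1) ≡ δ G γ
  D⁺-last G G-conj = δConj≡δ _ A G onto (λ x y y≡ → trans (G-conj x y (trans y≡ (rotation x))) (sym (rotation (A ⟨$⟩ʳ x)))) γ
    where
      rotation : ∀ x → indexOf (toℕ x) (orderAfter m s (suc s + u)) ≡ rotateBlock s e (toℕ x)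
      rotation x = indexOf-orderAfter-last m s u w (toℕ x) m≡ (FinP.toℕ<n x)
      onto : ∀ y → ∃ λ x → toℕ y ≡ indexOf (toℕ x) (orderAfter m s (suc s + u))
      onto y with rotateBlock-surjective m s e (ℕP.<-trans (ℕP.n<1+n s) s+1<e) e≤m y
      ... | x , y≡ = x , trans y≡ (sym (rotation x))

moveFirstLeg′ : ∀ {m} (A : Perm m) (p : Fin m) u w → m ≡ toℕ p + suc (suc u + w) →
  Closed A (toℕ p) (suc (suc (toℕ p) + u)) →
  (G : Fin m → Fin m) → Conjugate (λ x → rotateBlock (toℕ p) (suc (suc (toℕ p) + u)) (toℕ x)) A G →
  δₚ A ≈H δ G
moveFirstLeg′ A p u w m≡ closed G G-conj = InOT-resp arcs≡ oneAndTwoArcs-InOT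
  where
    open BlockMove A p (suc (suc (toℕ p) + u)) (s≤s (ℕP.m≤n⇒m≤1+n (ℕP.m≤m+n (toℕ p) u))) closed
    arcs≡ : ∀ γ → oneAndTwoArcs γ ≡ δ (A ⟨$⟩ʳ_) γ ⊖ δ G γ
    arcs≡ γ = begin
        oneAndTwoArcs γ                         ≡⟨ oneAndTwoArcs≡movesInBlock γ ⟩
        movesInBlock γ                          ≡⟨ Σ-move ⟩
        D⁻ (suc (toℕ p)) ⊖ D⁺ (suc (toℕ p) + u) ≡⟨ cong₂ _⊖_ D⁻-first (D⁺-last G G-conj) ⟩
        δ (A ⟨$⟩ʳ_) γ ⊖ δ G γ                   ∎
      where
        open ≡-Reasoning
        open Telescope A p u w m≡ γ

moveFirstLeg : ∀ {m} (A : Perm m) s e → s < e → e ≤ m → Closed A s e →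
  (G : Fin m → Fin m) → Conjugate (λ x → rotateBlock s e (toℕ x)) A G → δₚ A ≈H δ G
moveFirstLeg {m} A s e s<e e≤m closed G G-conj
  with Fin.fromℕ< (ℕP.<-≤-trans s<e e≤m) | FinP.toℕ-fromℕ< (ℕP.<-≤-trans s<e e≤m)
... | p | refl with ℕP.m≤n⇒∃[o]m+o≡n s<e | ℕP.m≤n⇒∃[o]m+o≡n e≤m
...   | zero , refl | _ = ≈H-reflexive (δ-cong λ x → sym (FinP.toℕ-injective
          (trans (G-conj x x (sym (fixed x))) (fixed (A ⟨$⟩ʳ x)))))
  where
    fixed : ∀ x → rotateBlock (toℕ p) (suc (toℕ p) + 0) (toℕ x) ≡ toℕ x
    fixed x = trans (cong (λ e → rotateBlock (toℕ p) e (toℕ x)) (ℕP.+-identityʳ (suc (toℕ p)))) (rotateBlock-singleton (toℕ p) (toℕ x))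
...   | suc u , refl | w , e+w≡m = moveFirstLeg′ A p u w m≡ (subst (Closed A (toℕ p)) e≡ closed) G
          (subst (λ e → Conjugate (λ x → rotateBlock (toℕ p) e (toℕ x)) A G) e≡ G-conj)
  where
    e≡ : suc (toℕ p) + suc u ≡ suc (suc (toℕ p) + u)
    e≡ = ℕP.+-suc (suc (toℕ p)) u
    m≡ : m ≡ toℕ p + suc (suc u + w)
    m≡ = trans (sym e+w≡m)
      (solve 3 (λ s u w → con 1 :+ s :+ (con 1 :+ u) :+ w := s :+ (con 1 :+ (con 1 :+ u :+ w))) refl (toℕ p) u w)
      where open ℕ-Solver

-- Rotations and concatenation

toℕ-σ : ∀ {n} (x : Fin (suc n)) → toℕ (σ x) ≡ suc (toℕ x) % suc n
toℕ-σ {n} x = FinP.toℕ-fromℕ< (m%n<n (suc (toℕ x)) (suc n))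

toℕ-σ⁻¹ : ∀ {n} (x : Fin (suc n)) → toℕ (σ⁻¹ x) ≡ rotateBlock 0 (suc n) (toℕ x)
toℕ-σ⁻¹ {n} Fin.zero = trans (FinP.toℕ-fromℕ< (m%n<n n (suc n))) (m<n⇒m%n≡m (ℕP.n<1+n n))
toℕ-σ⁻¹ {n} (Fin.suc x) = begin
    toℕ (σ⁻¹ (Fin.suc x))               ≡⟨ FinP.toℕ-fromℕ< (m%n<n (suc (toℕ x) + n) (suc n)) ⟩
    (suc (toℕ x) + n) % suc n           ≡⟨ cong (_% suc n) (sym (ℕP.+-suc (toℕ x) n)) ⟩
    (toℕ x + suc n) % suc n             ≡⟨ [m+n]%n≡m%n (toℕ x) (suc n) ⟩
    toℕ x % suc n                       ≡⟨ m<n⇒m%n≡m (ℕP.<-trans (FinP.toℕ<n x) (ℕP.n<1+n n)) ⟩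
    toℕ x                               ≡⟨ sym (rotateBlock-inside 0 (suc n) (suc (toℕ x)) (s≤s z≤n) (s≤s (FinP.toℕ<n x))) ⟩
    rotateBlock 0 (suc n) (suc (toℕ x)) ∎
  where open ≡-Reasoning

σ⁻¹-σ : ∀ {n} (x : Fin (suc n)) → σ⁻¹ (σ x) ≡ x
σ⁻¹-σ {n} x with toℕ x ℕ.≟ n
... | yes x≡n = FinP.toℕ-injective (trans (toℕ-σ⁻¹ (σ x))
      (trans (cong (rotateBlock 0 (suc n)) σx≡0) (trans (rotateBlock-start 0 (suc n)) (sym x≡n))))
  where
    σx≡0 : toℕ (σ x) ≡ 0
    σx≡0 = trans (toℕ-σ x) (trans (cong (λ k → suc k % suc n) x≡n) (n%n≡0 (suc n)))
... | no x≢n = FinP.toℕ-injective (trans (toℕ-σ⁻¹ (σ x))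
      (trans (cong (rotateBlock 0 (suc n)) (trans (toℕ-σ x) (m<n⇒m%n≡m (s≤s x<n))))
             (rotateBlock-inside 0 (suc n) (suc (toℕ x)) (s≤s z≤n) (s≤s x<n))))
  where
    x<n : toℕ x < n
    x<n = ℕP.≤∧≢⇒< (ℕP.≤-pred (FinP.toℕ<n x)) x≢n

σ-σ⁻¹ : ∀ {n} (x : Fin (suc n)) → σ (σ⁻¹ x) ≡ x
σ-σ⁻¹ {n} Fin.zero = FinP.toℕ-injective (trans (toℕ-σ (σ⁻¹ {n} Fin.zero))
  (trans (cong (λ k → suc k % suc n) (trans (toℕ-σ⁻¹ {n} Fin.zero) (rotateBlock-start 0 (suc n)))) (n%n≡0 (suc n))))
σ-σ⁻¹ {n} (Fin.suc x) = FinP.toℕ-injective (trans (toℕ-σ (σ⁻¹ (Fin.suc x)))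
  (trans (cong (λ k → suc k % suc n) σ⁻¹x+1≡x) (m<n⇒m%n≡m (s≤s (FinP.toℕ<n x)))))
  where
    σ⁻¹x+1≡x : toℕ (σ⁻¹ (Fin.suc x)) ≡ toℕ x
    σ⁻¹x+1≡x = trans (toℕ-σ⁻¹ (Fin.suc x)) (rotateBlock-inside 0 (suc n) (suc (toℕ x)) (s≤s z≤n) (s≤s (FinP.toℕ<n x)))

conjσ : ∀ {n} → Perm (suc n) → Perm (suc n)
conjσ α = permutation (λ x → σ⁻¹ (α ⟨$⟩ʳ σ x)) (λ x → σ⁻¹ (α ⟨$⟩ˡ σ x))
  (λ y → trans (cong (λ z → σ⁻¹ (α ⟨$⟩ʳ z)) (σ-σ⁻¹ _)) (trans (cong σ⁻¹ (inverseʳ α)) (σ⁻¹-σ y)))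
  (λ x → trans (cong (λ z → σ⁻¹ (α ⟨$⟩ˡ z)) (σ-σ⁻¹ _)) (trans (cong σ⁻¹ (inverseˡ α)) (σ⁻¹-σ x)))

conjσ^ : ∀ {n} → ℕ → Perm (suc n) → Perm (suc n)
conjσ^ zero    α = α
conjσ^ (suc k) α = conjσ (conjσ^ k α)

conjσ^-⟨$⟩ʳ : ∀ {n} k (α : Perm (suc n)) x → conjσ^ k α ⟨$⟩ʳ x ≡ rotℕ k (α ⟨$⟩ʳ_) x
conjσ^-⟨$⟩ʳ zero    α x = refl
conjσ^-⟨$⟩ʳ (suc k) α x = cong σ⁻¹ (conjσ^-⟨$⟩ʳ k α (σ x))

rotPerm : ∀ n → ℤ → Perm n → Perm n
rotPerm zero    i α = α
rotPerm (suc n) i α = conjσ^ (i %ℕ suc n) α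

rotPerm-⟨$⟩ʳ : ∀ n i (α : Perm n) x → rotPerm n i α ⟨$⟩ʳ x ≡ rot n i α x
rotPerm-⟨$⟩ʳ zero    i α x = refl
rotPerm-⟨$⟩ʳ (suc n) i α x = conjσ^-⟨$⟩ʳ (i %ℕ suc n) α x

module _ {a b : ℕ} where

  #-↑ˡ : (f : Fin a → Fin a) (g : Fin b → Fin b) (i : Fin a) → (f # g) (i ↑ˡ b) ≡ f i ↑ˡ b
  #-↑ˡ f g i rewrite FinP.splitAt-↑ˡ a i b = refl

  #-↑ʳ : (f : Fin a → Fin a) (g : Fin b → Fin b) (j : Fin b) → (f # g) (a ↑ʳ j) ≡ a ↑ʳ g j
  #-↑ʳ f g j rewrite FinP.splitAt-↑ʳ a b j = refl

  ↑ˡ-or-↑ʳ : (x : Fin (a + b)) → (∃ λ i → x ≡ i ↑ˡ b) ⊎ (∃ λ j → x ≡ a ↑ʳ j)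
  ↑ˡ-or-↑ʳ x with splitAt a x in eq
  ... | inj₁ i = inj₁ (i , sym (FinP.splitAt⁻¹-↑ˡ eq))
  ... | inj₂ j = inj₂ (j , sym (FinP.splitAt⁻¹-↑ʳ eq))

  #-cong : {f f′ : Fin a → Fin a} {g g′ : Fin b → Fin b} → (∀ i → f i ≡ f′ i) → (∀ j → g j ≡ g′ j) →
           ∀ x → (f # g) x ≡ (f′ # g′) x
  #-cong {f} {f′} {g} {g′} f≗f′ g≗g′ x with ↑ˡ-or-↑ʳ x
  ... | inj₁ (i , refl) = trans (#-↑ˡ f g i) (trans (cong (_↑ˡ b) (f≗f′ i)) (sym (#-↑ˡ f′ g′ i)))
  ... | inj₂ (j , refl) = trans (#-↑ʳ f g j) (trans (cong (a ↑ʳ_) (g≗g′ j)) (sym (#-↑ʳ f′ g′ j)))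

  #-inverse : {f f′ : Fin a → Fin a} {g g′ : Fin b → Fin b} → (∀ i → f (f′ i) ≡ i) → (∀ j → g (g′ j) ≡ j) →
              ∀ x → (f # g) ((f′ # g′) x) ≡ x
  #-inverse {f} {f′} {g} {g′} ff′ gg′ x with ↑ˡ-or-↑ʳ x
  ... | inj₁ (i , refl) rewrite #-↑ˡ f′ g′ i | #-↑ˡ f g (f′ i) = cong (_↑ˡ b) (ff′ i)
  ... | inj₂ (j , refl) rewrite #-↑ʳ f′ g′ j | #-↑ʳ f g (g′ j) = cong (a ↑ʳ_) (gg′ j)

  _#ₚ_ : Perm a → Perm b → Perm (a + b)
  α #ₚ β = permutation ((α ⟨$⟩ʳ_) # (β ⟨$⟩ʳ_)) ((α ⟨$⟩ˡ_) # (β ⟨$⟩ˡ_))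
    (#-inverse (λ _ → inverseʳ α) (λ _ → inverseʳ β))
    (#-inverse (λ _ → inverseˡ α) (λ _ → inverseˡ β))

-- σ⁻¹ α σ is α with its first leg moved to the end of the block of α.
#-conjσˡ : ∀ {n b} (α : Perm (suc n)) (β : Perm b) → δₚ (α #ₚ β) ≈H δₚ (conjσ α #ₚ β)
#-conjσˡ {n} {b} α β = moveFirstLeg (α #ₚ β) 0 (suc n) (s≤s z≤n) (ℕP.m≤m+n (suc n) b) closed _ conjugate
  where
    closed : Closed (α #ₚ β) 0 (suc n)
    closed x (_ , x<n+1) with ↑ˡ-or-↑ʳ {suc n} {b} x
    ... | inj₁ (i , refl) rewrite #-↑ˡ (α ⟨$⟩ʳ_) (β ⟨$⟩ʳ_) i | FinP.toℕ-↑ˡ (α ⟨$⟩ʳ i) b = z≤n , FinP.toℕ<n (α ⟨$⟩ʳ i)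
    ... | inj₂ (j , refl) rewrite FinP.toℕ-↑ʳ (suc n) j = ⊥-elim (ℕP.m+n≮m (suc n) (toℕ j) x<n+1)
    fixed : ∀ (j : Fin b) → rotateBlock 0 (suc n) (toℕ (suc n ↑ʳ j)) ≡ toℕ (suc n ↑ʳ j)
    fixed j = rotateBlock-above 0 (suc n) _ (s≤s z≤n) (subst (suc n ≤_) (sym (FinP.toℕ-↑ʳ (suc n) j)) (ℕP.m≤m+n (suc n) (toℕ j)))
    conjugate : Conjugate (λ x → rotateBlock 0 (suc n) (toℕ x)) (α #ₚ β) ((conjσ α ⟨$⟩ʳ_) # (β ⟨$⟩ʳ_))
    conjugate x y y≡ with ↑ˡ-or-↑ʳ {suc n} {b} x
    ... | inj₁ (i , refl) = begin
          toℕ (((conjσ α ⟨$⟩ʳ_) # (β ⟨$⟩ʳ_)) y)          ≡⟨ cong (λ z → toℕ (((conjσ α ⟨$⟩ʳ_) # (β ⟨$⟩ʳ_)) z)) y≡σ⁻¹i ⟩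
          toℕ (((conjσ α ⟨$⟩ʳ_) # (β ⟨$⟩ʳ_)) (σ⁻¹ i ↑ˡ b)) ≡⟨ cong toℕ (#-↑ˡ (conjσ α ⟨$⟩ʳ_) (β ⟨$⟩ʳ_) (σ⁻¹ i)) ⟩
          toℕ (σ⁻¹ (α ⟨$⟩ʳ σ (σ⁻¹ i)) ↑ˡ b)               ≡⟨ FinP.toℕ-↑ˡ _ b ⟩
          toℕ (σ⁻¹ (α ⟨$⟩ʳ σ (σ⁻¹ i)))                    ≡⟨ cong (λ z → toℕ (σ⁻¹ (α ⟨$⟩ʳ z))) (σ-σ⁻¹ i) ⟩
          toℕ (σ⁻¹ (α ⟨$⟩ʳ i))                            ≡⟨ toℕ-σ⁻¹ (α ⟨$⟩ʳ i) ⟩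
          rotateBlock 0 (suc n) (toℕ (α ⟨$⟩ʳ i))          ≡⟨ cong (rotateBlock 0 (suc n)) (sym (FinP.toℕ-↑ˡ (α ⟨$⟩ʳ i) b)) ⟩
          rotateBlock 0 (suc n) (toℕ (α ⟨$⟩ʳ i ↑ˡ b))     ≡⟨ cong (λ z → rotateBlock 0 (suc n) (toℕ z)) (sym (#-↑ˡ (α ⟨$⟩ʳ_) (β ⟨$⟩ʳ_) i)) ⟩
          rotateBlock 0 (suc n) (toℕ ((α #ₚ β) ⟨$⟩ʳ (i ↑ˡ b))) ∎
      where
        open ≡-Reasoning
        y≡σ⁻¹i : y ≡ σ⁻¹ i ↑ˡ b
        y≡σ⁻¹i = FinP.toℕ-injective (trans y≡ (trans (cong (rotateBlock 0 (suc n)) (FinP.toℕ-↑ˡ i b))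
                   (trans (sym (toℕ-σ⁻¹ i)) (sym (FinP.toℕ-↑ˡ (σ⁻¹ i) b)))))
    ... | inj₂ (j , refl) = begin
          toℕ (((conjσ α ⟨$⟩ʳ_) # (β ⟨$⟩ʳ_)) y)          ≡⟨ cong (λ z → toℕ (((conjσ α ⟨$⟩ʳ_) # (β ⟨$⟩ʳ_)) z)) (FinP.toℕ-injective (trans y≡ (fixed j))) ⟩
          toℕ (((conjσ α ⟨$⟩ʳ_) # (β ⟨$⟩ʳ_)) (suc n ↑ʳ j)) ≡⟨ cong toℕ (#-↑ʳ (conjσ α ⟨$⟩ʳ_) (β ⟨$⟩ʳ_) j) ⟩
          toℕ (suc n ↑ʳ (β ⟨$⟩ʳ j))                       ≡⟨ sym (fixed (β ⟨$⟩ʳ j)) ⟩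
          rotateBlock 0 (suc n) (toℕ (suc n ↑ʳ (β ⟨$⟩ʳ j))) ≡⟨ cong (λ z → rotateBlock 0 (suc n) (toℕ z)) (sym (#-↑ʳ (α ⟨$⟩ʳ_) (β ⟨$⟩ʳ_) j)) ⟩
          rotateBlock 0 (suc n) (toℕ ((α #ₚ β) ⟨$⟩ʳ (suc n ↑ʳ j))) ∎
      where open ≡-Reasoning

#-conjσʳ : ∀ {a n} (α : Perm a) (β : Perm (suc n)) → δₚ (α #ₚ β) ≈H δₚ (α #ₚ conjσ β)
#-conjσʳ {a} {n} α β = moveFirstLeg (α #ₚ β) a (a + suc n) (ℕP.m<m+n a (s≤s z≤n)) ℕP.≤-refl closed _ conjugate
  where
    closed : Closed (α #ₚ β) a (a + suc n)
    closed x (a≤x , _) with ↑ˡ-or-↑ʳ {a} {suc n} x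
    ... | inj₁ (i , refl) rewrite FinP.toℕ-↑ˡ i (suc n) = ⊥-elim (ℕP.<⇒≱ (FinP.toℕ<n i) a≤x)
    ... | inj₂ (j , refl) rewrite #-↑ʳ (α ⟨$⟩ʳ_) (β ⟨$⟩ʳ_) j | FinP.toℕ-↑ʳ a (β ⟨$⟩ʳ j) =
          ℕP.m≤m+n a _ , ℕP.+-monoʳ-< a (FinP.toℕ<n (β ⟨$⟩ʳ j))
    fixed : ∀ (i : Fin a) → rotateBlock a (a + suc n) (toℕ (i ↑ˡ suc n)) ≡ toℕ (i ↑ˡ suc n)
    fixed i = rotateBlock-below a (a + suc n) _ (subst (_< a) (sym (FinP.toℕ-↑ˡ i (suc n))) (FinP.toℕ<n i))
    shifted : ∀ (j : Fin (suc n)) → rotateBlock a (a + suc n) (toℕ (a ↑ʳ j)) ≡ a + rotateBlock 0 (suc n) (toℕ j)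
    shifted j = trans (cong (rotateBlock a (a + suc n)) (FinP.toℕ-↑ʳ a j)) (rotateBlock-+ a n (toℕ j) (FinP.toℕ<n j))
    conjugate : Conjugate (λ x → rotateBlock a (a + suc n) (toℕ x)) (α #ₚ β) ((α ⟨$⟩ʳ_) # (conjσ β ⟨$⟩ʳ_))
    conjugate x y y≡ with ↑ˡ-or-↑ʳ {a} {suc n} x
    ... | inj₁ (i , refl) = begin
          toℕ (((α ⟨$⟩ʳ_) # (conjσ β ⟨$⟩ʳ_)) y)            ≡⟨ cong (λ z → toℕ (((α ⟨$⟩ʳ_) # (conjσ β ⟨$⟩ʳ_)) z)) (FinP.toℕ-injective (trans y≡ (fixed i))) ⟩
          toℕ (((α ⟨$⟩ʳ_) # (conjσ β ⟨$⟩ʳ_)) (i ↑ˡ suc n)) ≡⟨ cong toℕ (#-↑ˡ (α ⟨$⟩ʳ_) (conjσ β ⟨$⟩ʳ_) i) ⟩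
          toℕ ((α ⟨$⟩ʳ i) ↑ˡ suc n)                        ≡⟨ sym (fixed (α ⟨$⟩ʳ i)) ⟩
          rotateBlock a (a + suc n) (toℕ ((α ⟨$⟩ʳ i) ↑ˡ suc n)) ≡⟨ cong (λ z → rotateBlock a (a + suc n) (toℕ z)) (sym (#-↑ˡ (α ⟨$⟩ʳ_) (β ⟨$⟩ʳ_) i)) ⟩
          rotateBlock a (a + suc n) (toℕ ((α #ₚ β) ⟨$⟩ʳ (i ↑ˡ suc n))) ∎
      where open ≡-Reasoning
    ... | inj₂ (j , refl) = begin
          toℕ (((α ⟨$⟩ʳ_) # (conjσ β ⟨$⟩ʳ_)) y)            ≡⟨ cong (λ z → toℕ (((α ⟨$⟩ʳ_) # (conjσ β ⟨$⟩ʳ_)) z)) y≡a+σ⁻¹j ⟩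
          toℕ (((α ⟨$⟩ʳ_) # (conjσ β ⟨$⟩ʳ_)) (a ↑ʳ σ⁻¹ j)) ≡⟨ cong toℕ (#-↑ʳ (α ⟨$⟩ʳ_) (conjσ β ⟨$⟩ʳ_) (σ⁻¹ j)) ⟩
          toℕ (a ↑ʳ σ⁻¹ (β ⟨$⟩ʳ σ (σ⁻¹ j)))               ≡⟨ cong (λ z → toℕ (a ↑ʳ σ⁻¹ (β ⟨$⟩ʳ z))) (σ-σ⁻¹ j) ⟩
          toℕ (a ↑ʳ σ⁻¹ (β ⟨$⟩ʳ j))                       ≡⟨ FinP.toℕ-↑ʳ a _ ⟩
          a + toℕ (σ⁻¹ (β ⟨$⟩ʳ j))                        ≡⟨ cong (a +_) (toℕ-σ⁻¹ (β ⟨$⟩ʳ j)) ⟩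
          a + rotateBlock 0 (suc n) (toℕ (β ⟨$⟩ʳ j))      ≡⟨ sym (shifted (β ⟨$⟩ʳ j)) ⟩
          rotateBlock a (a + suc n) (toℕ (a ↑ʳ (β ⟨$⟩ʳ j))) ≡⟨ cong (λ z → rotateBlock a (a + suc n) (toℕ z)) (sym (#-↑ʳ (α ⟨$⟩ʳ_) (β ⟨$⟩ʳ_) j)) ⟩
          rotateBlock a (a + suc n) (toℕ ((α #ₚ β) ⟨$⟩ʳ (a ↑ʳ j))) ∎
      where
        open ≡-Reasoning
        y≡a+σ⁻¹j : y ≡ a ↑ʳ σ⁻¹ j
        y≡a+σ⁻¹j = FinP.toℕ-injective (trans y≡ (trans (shifted j)
                     (trans (cong (a +_) (sym (toℕ-σ⁻¹ j))) (sym (FinP.toℕ-↑ʳ a (σ⁻¹ j))))))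

#-conjσ^ˡ : ∀ {n b} k (α : Perm (suc n)) (β : Perm b) → δₚ (α #ₚ β) ≈H δₚ (conjσ^ k α #ₚ β)
#-conjσ^ˡ zero    α β = ≈H-refl {v = δₚ (α #ₚ β)}
#-conjσ^ˡ (suc k) α β = begin
    δₚ (α #ₚ β)                  ∼⟨ #-conjσ^ˡ k α β ⟩
    δₚ (conjσ^ k α #ₚ β)         ∼⟨ #-conjσˡ (conjσ^ k α) β ⟩
    δₚ (conjσ^ (suc k) α #ₚ β)   ∎
  where open ≈H-Reasoning

#-conjσ^ʳ : ∀ {a n} k (α : Perm a) (β : Perm (suc n)) → δₚ (α #ₚ β) ≈H δₚ (α #ₚ conjσ^ k β)
#-conjσ^ʳ zero    α β = ≈H-refl {v = δₚ (α #ₚ β)}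
#-conjσ^ʳ (suc k) α β = begin
    δₚ (α #ₚ β)                  ∼⟨ #-conjσ^ʳ k α β ⟩
    δₚ (α #ₚ conjσ^ k β)         ∼⟨ #-conjσʳ α (conjσ^ k β) ⟩
    δₚ (α #ₚ conjσ^ (suc k) β)   ∎
  where open ≈H-Reasoning

#-rotPermˡ : ∀ a {b} i (α : Perm a) (β : Perm b) → δₚ (α #ₚ β) ≈H δₚ (rotPerm a i α #ₚ β)
#-rotPermˡ zero    i α β = ≈H-refl {v = δₚ (α #ₚ β)}
#-rotPermˡ (suc n) i α β = #-conjσ^ˡ (i %ℕ suc n) α β

#-rotPermʳ : ∀ {a} b j (α : Perm a) (β : Perm b) → δₚ (α #ₚ β) ≈H δₚ (α #ₚ rotPerm b j β)
#-rotPermʳ zero    j α β = ≈H-refl {v = δₚ (α #ₚ β)}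
#-rotPermʳ (suc n) j α β = #-conjσ^ʳ (j %ℕ suc n) α β

mainTheorem8 : (a b : ℕ) (α : Perm a) (β : Perm b) (i j : ℤ) →
    δ {a + b} ((α ⟨$⟩ʳ_) # (β ⟨$⟩ʳ_)) ≈H δ {a + b} (rot a i α # rot b j β)
mainTheorem8 a b α β i j = begin
    δₚ (α #ₚ β)                             ∼⟨ #-rotPermˡ a i α β ⟩
    δₚ (rotPerm a i α #ₚ β)                 ∼⟨ #-rotPermʳ b j (rotPerm a i α) β ⟩
    δₚ (rotPerm a i α #ₚ rotPerm b j β)     ∼⟨ ≈H-reflexive (δ-cong (#-cong (rotPerm-⟨$⟩ʳ a i α) (rotPerm-⟨$⟩ʳ b j β))) ⟩
    δ (rot a i α # rot b j β)               ∎
  where open ≈H-Reasoning
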